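{- Let $L=\mathbb Q(\sqrt{ -d})$ be an imaginary quadratic field with discriminant $-d$, and $M$ an odd square-free positive integer all of whose prime divisors are inert in $L$. Then there exists an integer $b$ such that $4\mid b^2+d$ and, for every prime $p\mid M$, the element $(-b+\sqrt{ -d})/2$ generates the group $\mathbb Z_{L,p}^\times/\Gamma^0_{L,p}$.
   Context: For a prime $p\mid M$, $L_p=L\otimes\mathbb Q_p$ and $\mathbb Z_{L,p}^\times=\{x+y\sqrt{ -d}: x,y\in\mathbb Z_p\text{ not both divisible by }p\}$ is the unit group of its ring of integers; $\Gamma^0_{L,p}$ is its subgroup of elements $x+y\sqrt{ -d}$ with $p\mid y$. The quotient $\mathbb Z_{L,p}^\times/\Gamma^0_{L,p}$ is cyclic of order $p+1$. -}

module Defs where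

open import Data.Nat as ℕ using (ℕ; suc)
open import Data.Nat.Primality using (Prime)
open import Data.Nat.Divisibility using (_∣_)
open import Data.Nat.DivMod using (_%_; _/_)
open import Data.Integer as ℤ using (ℤ; +_; _+_; _-_; _*_; -_)
open import Data.Integer.Divisibility renaming (_∣_ to _∣ℤ_)
open import Data.Product using (Σ; _×_; ∃; ∃-syntax)
open import Data.Sum using (_⊎_)
open import Relation.Nullary using (¬_)
open import Relation.Binary.PropositionalEquality using (_≡_)

SquareFree : ℕ → Set
SquareFree n = ∀ (q : ℕ) → q ℕ.* q ∣ n → q ≡ 1

NegFundDisc : ℕ → Set
NegFundDisc d =
  (d % 4 ≡ 3 × SquareFree d)
  ⊎ (∃[ m ] (d ≡ 4 ℕ.* m × (m % 4 ≡ 1 ⊎ m % 4 ≡ 2) × SquareFree m))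

-- An odd prime p is inert in L = Q(√-d) (disc -d): the Kronecker
-- symbol (-d/p) is -1, i.e. p ∤ d and -d is not a square mod p.
InertOdd : ℕ → ℕ → Set
InertOdd d p = ¬ (p ∣ d) × ¬ (∃[ x ] ((+ p) ∣ℤ (x * x + + d)))

-- Elements x + y√-d of L_p with x,y taken as integer representatives
-- (ℤ is dense in ℤ_p, and everything below depends only on x,y mod p).
record Elt : Set where
  constructor ⟨_,_⟩
  field
    re : ℤ
    im : ℤ
open Elt public

mul : ℕ → Elt → Elt → Elt
mul d ⟨ x , y ⟩ ⟨ x' , y' ⟩ = ⟨ x * x' - (+ d) * (y * y') , x * y' + y * x' ⟩

pow : ℕ → Elt → ℕ → Elt
pow d u 0 = ⟨ + 1 , + 0 ⟩
pow d u (suc k) = mul d u (pow d u k)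

IsUnit : ℕ → Elt → Set
IsUnit p ⟨ x , y ⟩ = ¬ (((+ p) ∣ℤ x) × ((+ p) ∣ℤ y))

InGamma0 : ℕ → Elt → Set
InGamma0 p g = IsUnit p g × ((+ p) ∣ℤ im g)

_≡[_]_ : Elt → ℕ → Elt → Set
u ≡[ p ] v = ((+ p) ∣ℤ (re u - re v)) × ((+ p) ∣ℤ (im u - im v))

SameClass : ℕ → ℕ → Elt → Elt → Set
SameClass d p u v = Σ Elt (λ g → InGamma0 p g × (u ≡[ p ] mul d v g))

Generates : ℕ → ℕ → Elt → Set
Generates d p α = ∀ (u : Elt) → IsUnit p u → ∃[ k ] SameClass d p (pow d α k) u

-- (p+1)/2, the inverse of 2 in ℤ_p for odd p
half : ℕ → ℤ
half p = + ((p ℕ.+ 1) / 2)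

alpha : ℕ → ℤ → Elt
alpha p b = ⟨ (- b) * half p , half p ⟩

{-# OPTIONS --safe #-}
-- Modulo an inert prime p, ℤ[√-d] becomes the field 𝔽_{p²}, and ℤ_{L,p}^×/Γ⁰_{L,p} is
-- 𝔽_{p²}^×/𝔽ₚ^×: the class of x + y√-d is the point [x : y] of ℙ¹(𝔽ₚ), so there are p + 1
-- classes.  If no power αᵐ with 1 ≤ m ≤ p lies in 𝔽ₚ, then by pigeonhole on ℙ¹(𝔽ₚ) every class
-- is a power of α.  Such a primitive α exists by the exponent argument for cyclicity: while the
-- largest order a found is at most p, some x has xᵃ ∉ 𝔽ₚ (for a < p because im((t + √-d)ᵃ) is a
-- polynomial of degree a - 1 with leading coefficient a, which cannot vanish at t = 0, …, a - 1;
-- for a = p take √-d), and trading prime-power parts of the orders of α and x gives a larger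
-- order.  Scaling by 𝔽ₚ^× does not move classes, so (-b + √-d)/2 generates whenever
-- b ≡ -x/y (mod p) for a primitive x + y√-d; the Chinese remainder theorem combines these
-- congruences over the primes dividing M with b² + d ≡ 0 (mod 4).
module Submission where

open import Defs
open import Data.Nat as ℕ using (ℕ; zero; suc; z≤n; s≤s; _<_; _≤_)
import Data.Nat.Properties as ℕP
open import Data.Nat.DivMod using (_%_; _/_; m≡m%n+[m/n]*n; m%n<n; m*n/n≡m)
open import Data.Nat.Divisibility as ℕD using (_∣_; _∣?_)
open import Data.Nat.Coprimality as Coprimality using (Coprime; coprime-Bézout; coprime-divisor)
open import Data.Nat.GCD using (module Bézout; gcd; gcd[m,n]∣m; gcd[m,n]∣n; gcd-greatest)
open import Data.Nat.LCM using (lcm; lcm-least; gcd*lcm)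
open import Data.Nat.Primality
  using (Prime; prime?; euclidsLemma; prime⇒irreducible; prime⇒nonTrivial; prime⇒nonZero)
open import Data.Nat.Primality.Factorisation using (factorise; module PrimeFactorisation)
open import Data.Nat.ListAction using (product)
import Data.Nat.Tactic.RingSolver as ℕSolver
open import Data.Integer as ℤ using (ℤ; +_; -[1+_]; _+_; _-_; _*_; -_; 0ℤ; 1ℤ)
import Data.Integer.Properties as ℤP
open import Data.Integer.Divisibility using () renaming (_∣_ to _∣ℤ_)
open import Data.Integer.Divisibility.Signed as ℤD using (∣ᵤ⇒∣; ∣⇒∣ᵤ) renaming (_∣_ to _∣ˢ_)
open import Data.Integer.DivMod using (_%ℕ_; _/ℕ_; a≡a%ℕn+[a/ℕn]*n; n%ℕd<d)
open import Data.Integer.Tactic.RingSolver using (solve-∀)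
open import Data.Fin using (Fin; toℕ; fromℕ; fromℕ<)
import Data.Fin.Properties as Fin
open import Data.List using (List; []; _∷_)
open import Data.List.Relation.Unary.All as List using ([]; _∷_)
open import Data.Vec using (Vec; []; _∷_)
open import Data.Vec.Relation.Unary.All as All using (All; []; _∷_)
open import Data.Vec.Relation.Unary.AllPairs using (AllPairs; []; _∷_)
open import Data.Product using (_×_; _,_; proj₁; proj₂; ∃; ∃₂; ∃-syntax)
open import Data.Sum as Sum using (_⊎_; inj₁; inj₂; [_,_]′)
open import Data.Empty using (⊥-elim)
open import Function using (_∘_; _∘′_; _$_; id; flip)
open import Relation.Nullary using (¬_; Dec; yes; no; contradiction)
open import Relation.Nullary.Decidable using (decidable-stable; ¬?; _×-dec_)
open import Relation.Binary.PropositionalEquality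

-- Arithmetic modulo a prime

∣0 : ∀ {k} → k ∣ˢ 0ℤ
∣0 = ℤD.divides 0ℤ refl

euclidsLemmaℤ : ∀ {p} → Prime p → ∀ a b → + p ∣ˢ a * b → + p ∣ˢ a ⊎ + p ∣ˢ b
euclidsLemmaℤ {p} p-prime a b p∣ab =
  Sum.map ∣ᵤ⇒∣ ∣ᵤ⇒∣ (euclidsLemma ℤ.∣ a ∣ ℤ.∣ b ∣ p-prime (subst (p ∣_) (ℤP.abs-* a b) (∣⇒∣ᵤ p∣ab)))

prime>1 : ∀ {p} → Prime p → 1 < p
prime>1 {p} p-prime = ℕ.nonTrivial⇒n>1 p {{prime⇒nonTrivial p-prime}}

prime∤1 : ∀ {p} → Prime p → ¬ + p ∣ˢ 1ℤ
prime∤1 p-prime p∣1 = ℕP.<-irrefl (sym (ℕD.∣1⇒≡1 (∣⇒∣ᵤ p∣1))) (prime>1 p-prime)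

prime∤^ : ∀ {p} → Prime p → ∀ {c} → ¬ + p ∣ˢ c → ∀ m → ¬ + p ∣ˢ c ℤ.^ m
prime∤^ p-prime p∤c zero = prime∤1 p-prime
prime∤^ p-prime {c} p∤c (suc m) p∣c^[1+m] =
  [ p∤c , prime∤^ p-prime p∤c m ]′ (euclidsLemmaℤ p-prime c (c ℤ.^ m) p∣c^[1+m])

prime∤⇒coprime : ∀ {p n} → Prime p → ¬ p ∣ n → Coprime p n
prime∤⇒coprime p-prime p∤n (i∣p , i∣n) with prime⇒irreducible p-prime i∣p
... | inj₁ i≡1 = i≡1
... | inj₂ refl = contradiction i∣n p∤n

private
  pos-identity : ∀ a b c d e → a ℕ.+ b ℕ.* c ≡ d ℕ.* e → + a + + b * + c ≡ + d * + e
  pos-identity a b c d e eq = begin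
    + a + + b * + c     ≡⟨ cong (λ z → + a + z) (ℤP.pos-* b c) ⟨
    + a + + (b ℕ.* c)   ≡⟨ ℤP.pos-+ a (b ℕ.* c) ⟨
    + (a ℕ.+ b ℕ.* c)   ≡⟨ cong +_ eq ⟩
    + (d ℕ.* e)         ≡⟨ ℤP.pos-* d e ⟩
    + d * + e           ∎
    where open ≡-Reasoning

  cancel-one : ∀ (m n x y : ℤ) → 1ℤ + y * n ≡ x * m → m * x + n * (- y) ≡ 1ℤ
  cancel-one m n x y eq = begin
    m * x + n * (- y)          ≡⟨ rearrange m n x y ⟩
    x * m - y * n              ≡⟨ cong (_- y * n) eq ⟨
    (1ℤ + y * n) - y * n       ≡⟨ cancel (y * n) ⟩
    1ℤ                         ∎
    where
    open ≡-Reasoning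
    rearrange : ∀ (m n x y : ℤ) → m * x + n * (- y) ≡ x * m - y * n
    rearrange = solve-∀
    cancel : ∀ z → (1ℤ + z) - z ≡ 1ℤ
    cancel = solve-∀

bézoutℤ : ∀ {m n} → Coprime m n → ∃₂ λ x y → + m * x + + n * y ≡ 1ℤ
bézoutℤ c = fromIdentity (coprime-Bézout c)
  where
  fromIdentity : ∀ {m n} → Bézout.Identity 1 m n → ∃₂ λ x y → + m * x + + n * y ≡ 1ℤ
  fromIdentity {m} {n} (Bézout.+- x y eq) =
    + x , - + y , cancel-one (+ m) (+ n) (+ x) (+ y) (pos-identity 1 y n x m eq)
  fromIdentity {m} {n} (Bézout.-+ x y eq) with fromIdentity {n} {m} (Bézout.+- y x eq)
  ... | y′ , x′ , e = x′ , y′ , trans (ℤP.+-comm (+ m * x′) (+ n * y′)) e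

private
  bézout⇒congruence : ∀ (m n x y : ℤ) → m * x + n * y ≡ 1ℤ → n * y - 1ℤ ≡ (- x) * m
  bézout⇒congruence m n x y eq = begin
    n * y - 1ℤ                ≡⟨ cong (λ z → n * y - z) eq ⟨
    n * y - (m * x + n * y)   ≡⟨ simplify m n x y ⟩
    (- x) * m                 ∎
    where
    open ≡-Reasoning
    simplify : ∀ (m n x y : ℤ) → n * y - (m * x + n * y) ≡ (- x) * m
    simplify = solve-∀

  +∣i∣≡i⊎+∣i∣≡-i : ∀ i → + ℤ.∣ i ∣ ≡ i ⊎ + ℤ.∣ i ∣ ≡ - i
  +∣i∣≡i⊎+∣i∣≡-i (+ n) = inj₁ refl
  +∣i∣≡i⊎+∣i∣≡-i -[1+ n ] = inj₂ refl

  *-neg : ∀ a y → a * (- y) ≡ (- a) * y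
  *-neg = solve-∀

inverse-mod : ∀ {p} → Prime p → ∀ a → ¬ + p ∣ˢ a → ∃ λ a⁻¹ → + p ∣ˢ a * a⁻¹ - 1ℤ
inverse-mod {p} p-prime a p∤a with bézoutℤ (prime∤⇒coprime {n = ℤ.∣ a ∣} p-prime (p∤a ∘ ∣ᵤ⇒∣))
... | x , y , eq with +∣i∣≡i⊎+∣i∣≡-i a
...   | inj₁ ∣a∣≡a = y , ℤD.divides (- x)
          (bézout⇒congruence (+ p) a x y (subst (λ z → + p * x + z * y ≡ 1ℤ) ∣a∣≡a eq))
...   | inj₂ ∣a∣≡-a = - y , ℤD.divides (- x) (trans (cong (_- 1ℤ) (*-neg a y))
          (bézout⇒congruence (+ p) (- a) x y (subst (λ z → + p * x + z * y ≡ 1ℤ) ∣a∣≡-a eq)))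

chineseRemainder : ∀ {m n} → Coprime m n → ∀ b c → ∃ λ z → + m ∣ˢ z - b × + n ∣ˢ z - c
chineseRemainder {m} {n} coprime b c with bézoutℤ coprime
... | x , y , eq = b * (+ n * y) + c * (+ m * x)
                 , ℤD.divides ((c - b) * x) (residue b c (+ m) (+ n) x y eq)
                 , ℤD.divides ((b - c) * y)
                     (trans (cong (_- c) (ℤP.+-comm (b * (+ n * y)) _))
                            (residue c b (+ n) (+ m) y x (trans (ℤP.+-comm (+ n * y) _) eq)))
  where
  open ≡-Reasoning
  expand : ∀ (b c m n x y : ℤ) →
           b * (n * y) + c * (m * x) - b ≡ (c - b) * x * m + b * (m * x + n * y - 1ℤ)
  expand = solve-∀
  drop-zero : ∀ (b z : ℤ) → z + b * (1ℤ - 1ℤ) ≡ z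
  drop-zero = solve-∀
  residue : ∀ (b c m n x y : ℤ) → m * x + n * y ≡ 1ℤ → b * (n * y) + c * (m * x) - b ≡ (c - b) * x * m
  residue b c m n x y eq = begin
    b * (n * y) + c * (m * x) - b               ≡⟨ expand b c m n x y ⟩
    (c - b) * x * m + b * (m * x + n * y - 1ℤ)  ≡⟨ cong (λ z → (c - b) * x * m + b * (z - 1ℤ)) eq ⟩
    (c - b) * x * m + b * (1ℤ - 1ℤ)             ≡⟨ drop-zero b _ ⟩
    (c - b) * x * m                             ∎

%ℕ≡⇒∣- : ∀ {p} .{{_ : ℕ.NonZero p}} a b → a %ℕ p ≡ b %ℕ p → + p ∣ˢ a - b
%ℕ≡⇒∣- {p} a b eq = ℤD.divides (a /ℕ p - b /ℕ p) (begin
  a - b                                                           ≡⟨ cong₂ _-_ (a≡a%ℕn+[a/ℕn]*n a p) (a≡a%ℕn+[a/ℕn]*n b p) ⟩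
  (+ (a %ℕ p) + (a /ℕ p) * + p) - (+ (b %ℕ p) + (b /ℕ p) * + p)   ≡⟨ cong (λ r → (+ (a %ℕ p) + (a /ℕ p) * + p) - (+ r + (b /ℕ p) * + p)) eq ⟨
  (+ (a %ℕ p) + (a /ℕ p) * + p) - (+ (a %ℕ p) + (b /ℕ p) * + p)   ≡⟨ cancel (+ (a %ℕ p)) (a /ℕ p) (b /ℕ p) (+ p) ⟩
  (a /ℕ p - b /ℕ p) * + p                                         ∎)
  where
  open ≡-Reasoning
  cancel : ∀ r q q′ P → (r + q * P) - (r + q′ * P) ≡ (q - q′) * P
  cancel = solve-∀

-- Bounded search

all<⊎counterexample : ∀ {P : ℕ → Set} → (∀ n → Dec (P n)) → ∀ n →
                      (∀ t → t < n → P t) ⊎ ∃ λ t → t < n × ¬ P t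
all<⊎counterexample {P} P? n with Fin.all? {n} (P? ∘ toℕ)
... | yes all = inj₁ λ t t<n → subst P (Fin.toℕ-fromℕ< t<n) (all (fromℕ< t<n))
... | no ¬all with Fin.¬∀⟶∃¬ n (P ∘ toℕ) (P? ∘ toℕ) ¬all
...   | i , ¬Pi = inj₂ (toℕ i , Fin.toℕ<n i , ¬Pi)

least< : ∀ {P : ℕ → Set} → (∀ n → Dec (P n)) → ∀ n →
         (∀ j → j < n → ¬ P j) ⊎ ∃ λ o → o < n × P o × (∀ j → j < o → ¬ P j)
least< P? zero = inj₁ λ _ ()
least< P? (suc n) with least< P? n
... | inj₂ (o , o<n , Po , min) = inj₂ (o , ℕP.m<n⇒m<1+n o<n , Po , min)
... | inj₁ none with P? n
...   | yes Pn = inj₂ (n , ℕP.n<1+n n , Pn , none)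
...   | no ¬Pn = inj₁ λ j j<1+n → [ none j , (λ { refl → ¬Pn }) ]′ (ℕP.m≤n⇒m<n∨m≡n (ℕP.≤-pred j<1+n))

leastPositive : ∀ {P : ℕ → Set} → (∀ n → Dec (P n)) → ∀ {m} → 0 < m → P m →
                ∃ λ o → 0 < o × o ≤ m × P o × (∀ j → 0 < j → j < o → ¬ P j)
leastPositive P? {suc m} _ Pm with least< (P? ∘ suc) (suc m)
... | inj₁ none = contradiction Pm (none m (ℕP.n<1+n m))
... | inj₂ (o , o<1+m , Po , min) =
  suc o , s≤s z≤n , o<1+m , Po , λ { (suc j) _ (s≤s j<o) → min j j<o }

-- Polynomials over ℤ

-- Coefficient sequences; eval n c t = Σ_{k<n} c k · tᵏ only reads the first n coefficients.
Poly : Set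
Poly = ℕ → ℤ

tail : Poly → Poly
tail c k = c (suc k)

shift : Poly → Poly
shift c zero = 0ℤ
shift c (suc k) = c k

eval : ℕ → Poly → ℤ → ℤ
eval zero c t = 0ℤ
eval (suc n) c t = c 0 + t * eval n (tail c) t

eval-+ : ∀ n a b t → eval n (λ k → a k + b k) t ≡ eval n a t + eval n b t
eval-+ zero a b t = refl
eval-+ (suc n) a b t = trans (cong (λ z → (a 0 + b 0) + t * z) (eval-+ n (tail a) (tail b) t))
                             (distrib (a 0) (b 0) t _ _)
  where
  distrib : ∀ a₀ b₀ t A B → (a₀ + b₀) + t * (A + B) ≡ (a₀ + t * A) + (b₀ + t * B)
  distrib = solve-∀

eval-* : ∀ n x a t → eval n (λ k → x * a k) t ≡ x * eval n a t
eval-* zero x a t = sym (ℤP.*-zeroʳ x)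
eval-* (suc n) x a t = trans (cong (λ z → x * a 0 + t * z) (eval-* n x (tail a) t)) (distrib x (a 0) t _)
  where
  distrib : ∀ x a₀ t A → x * a₀ + t * (x * A) ≡ x * (a₀ + t * A)
  distrib = solve-∀

eval-shift : ∀ n c t → eval (suc n) (shift c) t ≡ t * eval n c t
eval-shift n c t = ℤP.+-identityˡ _

eval-dropLast : ∀ n c t → c n ≡ 0ℤ → eval (suc n) c t ≡ eval n c t
eval-dropLast zero c t c₀≡0 = cong₂ _+_ c₀≡0 (ℤP.*-zeroʳ t)
eval-dropLast (suc n) c t cₙ≡0 = cong (λ z → c 0 + t * z) (eval-dropLast n (tail c) t cₙ≡0)

divideBy : ℤ → ℕ → Poly → Poly
divideBy r zero c _ = 0ℤ
divideBy r (suc n) c zero = eval (suc n) (tail c) r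
divideBy r (suc n) c (suc k) = divideBy r n (tail c) k

factor-theorem : ∀ n c t r → eval (suc n) c t - eval (suc n) c r ≡ (t - r) * eval n (divideBy r n c) t
factor-theorem zero c t r = base (c 0) t r
  where
  base : ∀ c₀ t r → (c₀ + t * 0ℤ) - (c₀ + r * 0ℤ) ≡ (t - r) * 0ℤ
  base = solve-∀
factor-theorem (suc n) c t r = begin
  (c 0 + t * A) - (c 0 + r * B)                         ≡⟨ split (c 0) t r A B Q ⟩
  (t - r) * (B + t * Q) + t * ((A - B) - (t - r) * Q)   ≡⟨ cong (λ z → (t - r) * (B + t * Q) + t * z)
                                                              (m≡n⇒m-n≡0 (factor-theorem n (tail c) t r)) ⟩
  (t - r) * (B + t * Q) + t * 0ℤ                        ≡⟨ drop (t - r) B t Q ⟩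
  (t - r) * (B + t * Q)                                 ∎
  where
  open ≡-Reasoning
  A = eval (suc n) (tail c) t
  B = eval (suc n) (tail c) r
  Q = eval n (divideBy r n (tail c)) t
  split : ∀ c₀ t r A B Q → (c₀ + t * A) - (c₀ + r * B) ≡ (t - r) * (B + t * Q) + t * ((A - B) - (t - r) * Q)
  split = solve-∀
  drop : ∀ x B t Q → x * (B + t * Q) + t * 0ℤ ≡ x * (B + t * Q)
  drop = solve-∀
  m≡n⇒m-n≡0 : ∀ {m n} → m ≡ n → m - n ≡ 0ℤ
  m≡n⇒m-n≡0 {m} refl = ℤP.+-inverseʳ m

naturals : ∀ n → Vec ℤ n
naturals zero = []
naturals (suc n) = + n ∷ naturals n

naturals-all : ∀ {P : ℤ → Set} n → (∀ t → t < n → P (+ t)) → All P (naturals n)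
naturals-all zero _ = []
naturals-all (suc n) P<1+n = P<1+n n (ℕP.n<1+n n) ∷ naturals-all n (λ t t<n → P<1+n t (ℕP.m<n⇒m<1+n t<n))

∤-difference : ∀ {p m n} → m < n → n < p → ¬ + p ∣ˢ + m - + n
∤-difference {p} {m} {n} m<n n<p p∣m-n = ℕP.<-irrefl refl (begin-strict
  p        ≤⟨ ℕD.∣⇒≤ {{ℕ.>-nonZero (ℕP.m<n⇒0<n∸m m<n)}} (∣⇒∣ᵤ {i = + (n ℕ.∸ m)} (subst (+ p ∣ˢ_) n-m≡ (ℤD.∣m⇒∣-m p∣m-n))) ⟩
  n ℕ.∸ m  ≤⟨ ℕP.m∸n≤m n m ⟩
  n        <⟨ n<p ⟩
  p        ∎)
  where
  open ℕP.≤-Reasoning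
  neg-difference : ∀ a b → - (a - b) ≡ b - a
  neg-difference = solve-∀
  n-m≡ : - (+ m - + n) ≡ + (n ℕ.∸ m)
  n-m≡ = trans (neg-difference (+ m) (+ n)) (trans (ℤP.m-n≡m⊖n n m) (ℤP.⊖-≥ (ℕP.<⇒≤ m<n)))

naturals-incongruent : ∀ {p} n → n ≤ p → AllPairs (λ r s → ¬ + p ∣ˢ s - r) (naturals n)
naturals-incongruent zero _ = []
naturals-incongruent {p} (suc n) 1+n≤p =
  naturals-all n (λ t t<n → ∤-difference t<n 1+n≤p) ∷ naturals-incongruent n (ℕP.<⇒≤ 1+n≤p)

even⊎odd : ∀ n → ∃ λ k → n ≡ k ℕ.* 2 ⊎ n ≡ suc (k ℕ.* 2)
even⊎odd zero = 0 , inj₁ refl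
even⊎odd (suc n) with even⊎odd n
... | k , inj₁ n≡2k = k , inj₂ (cong suc n≡2k)
... | k , inj₂ n≡2k+1 = suc k , inj₁ (cong suc n≡2k+1)

odd⇒≡suc[k*2] : ∀ {n} → ¬ 2 ∣ n → ∃ λ k → n ≡ suc (k ℕ.* 2)
odd⇒≡suc[k*2] {n} 2∤n with even⊎odd n
... | k , inj₁ n≡2k = contradiction (ℕD.divides k n≡2k) 2∤n
... | k , inj₂ n≡2k+1 = k , n≡2k+1

module _ {p : ℕ} (p-prime : Prime p) where

  private
    constant-term : ∀ c₀ r E → c₀ ≡ (c₀ + r * E) - r * E
    constant-term = solve-∀

  ∣coefficients-of-root : ∀ n c r → + p ∣ˢ eval (suc n) c r →
                          (∀ k → k < n → + p ∣ˢ divideBy r n c k) → ∀ k → k < suc n → + p ∣ˢ c k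
  ∣coefficients-of-root zero c r p∣c[r] _ zero _ =
    subst (+ p ∣ˢ_) (sym (constant-term (c 0) r 0ℤ)) (ℤD.∣m∣n⇒∣m-n p∣c[r] (ℤD.∣n⇒∣m*n r ∣0))
  ∣coefficients-of-root zero c r _ _ (suc k) (s≤s ())
  ∣coefficients-of-root (suc n) c r p∣c[r] p∣q zero _ =
    subst (+ p ∣ˢ_) (sym (constant-term (c 0) r _)) (ℤD.∣m∣n⇒∣m-n p∣c[r] (ℤD.∣n⇒∣m*n r (p∣q 0 (s≤s z≤n))))
  ∣coefficients-of-root (suc n) c r p∣c[r] p∣q (suc k) (s≤s k<1+n) =
    ∣coefficients-of-root n (tail c) r (p∣q 0 (s≤s z≤n)) (λ k k<n → p∣q (suc k) (s≤s k<n)) k k<1+n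

  roots⇒∣coefficients : ∀ n c {rs : Vec ℤ n} → AllPairs (λ r s → ¬ + p ∣ˢ s - r) rs →
                        All (λ r → + p ∣ˢ eval n c r) rs → ∀ k → k < n → + p ∣ˢ c k
  roots⇒∣coefficients zero c [] [] k ()
  roots⇒∣coefficients (suc n) c {r ∷ rs} (r≢rs ∷ distinct) (root ∷ roots) =
    ∣coefficients-of-root n c r root
      (roots⇒∣coefficients n (divideBy r n c) distinct (All.map rootOfQuotient (All.zip (r≢rs , roots))))
    where
    rootOfQuotient : ∀ {s} → ¬ + p ∣ˢ s - r × + p ∣ˢ eval (suc n) c s → + p ∣ˢ eval n (divideBy r n c) s
    rootOfQuotient {s} (p∤s-r , p∣c[s]) =
      [ flip contradiction p∤s-r , id ]′
        (euclidsLemmaℤ p-prime (s - r) _ (subst (+ p ∣ˢ_) (factor-theorem n c s r) (ℤD.∣m∣n⇒∣m-n p∣c[s] root)))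

-- Prime powers

∃primeDivisor : ∀ {n} → 1 < n → ∃ λ q → Prime q × q ∣ n
∃primeDivisor {n} 1<n = go factors isFactorisation factorsPrime
  where
  open PrimeFactorisation (factorise n {{ℕ.>-nonZero (ℕP.<-trans (s≤s z≤n) 1<n)}})
  go : ∀ qs → n ≡ product qs → List.All Prime qs → ∃ λ q → Prime q × q ∣ n
  go [] n≡1 _ = contradiction n≡1 (ℕP.>⇒≢ 1<n)
  go (q ∷ qs) n≡q*qs (q-prime ∷ _) = q , q-prime , ℕD.divides (product qs) (trans n≡q*qs (ℕP.*-comm q _))

n<m^n : ∀ {m} n → 1 < m → n < m ℕ.^ n
n<m^n zero _ = s≤s z≤n
n<m^n {m} (suc n) 1<m = begin-strict
  suc n          ≤⟨ n<m^n n 1<m ⟩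
  m ℕ.^ n        <⟨ ℕP.m<m*n (m ℕ.^ n) m {{ℕ.>-nonZero (ℕP.<-≤-trans (s≤s z≤n) (n<m^n n 1<m))}} 1<m ⟩
  m ℕ.^ n ℕ.* m  ≡⟨ ℕP.*-comm (m ℕ.^ n) m ⟩
  m ℕ.^ suc n    ∎
  where open ℕP.≤-Reasoning

valuation : ∀ {q a} → 1 < q → 0 < a → ∃ λ f → q ℕ.^ f ∣ a × ¬ q ℕ.^ suc f ∣ a
valuation {q} {a} 1<q 0<a with least< (λ f → ¬? (q ℕ.^ f ∣? a)) (suc a)
... | inj₁ none = ⊥-elim $ none a (ℕP.n<1+n a) λ q^a∣a →
  ℕP.<-irrefl refl (ℕP.<-≤-trans (n<m^n a 1<q) (ℕD.∣⇒≤ {{ℕ.>-nonZero 0<a}} q^a∣a))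
... | inj₂ (zero , _ , ¬1∣a , _) = contradiction (ℕD.1∣ a) ¬1∣a
... | inj₂ (suc f , _ , ¬q^[1+f]∣a , min) =
  f , decidable-stable (q ℕ.^ f ∣? a) (min f (ℕP.n<1+n f)) , ¬q^[1+f]∣a

^-monoʳ-∣ : ∀ q {e f} → e ≤ f → q ℕ.^ e ∣ q ℕ.^ f
^-monoʳ-∣ q {e} {f} e≤f = ℕD.divides (q ℕ.^ (f ℕ.∸ e)) (begin
  q ℕ.^ f                      ≡⟨ cong (q ℕ.^_) (ℕP.m+[n∸m]≡n e≤f) ⟨
  q ℕ.^ (e ℕ.+ (f ℕ.∸ e))      ≡⟨ ℕP.^-distribˡ-+-* q e (f ℕ.∸ e) ⟩
  q ℕ.^ e ℕ.* q ℕ.^ (f ℕ.∸ e)  ≡⟨ ℕP.*-comm (q ℕ.^ e) _ ⟩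
  q ℕ.^ (f ℕ.∸ e) ℕ.* q ℕ.^ e  ∎)
  where open ≡-Reasoning

coprime-* : ∀ {m n o} → Coprime m n → Coprime m o → Coprime m (n ℕ.* o)
coprime-* {n = n} m⊥n m⊥o (i∣m , i∣n*o) = m⊥o (i∣m , coprime-divisor i⊥n i∣n*o)
  where
  i⊥n : Coprime _ n
  i⊥n (j∣i , j∣n) = m⊥n (ℕD.∣-trans j∣i i∣m , j∣n)

prime∤⇒coprime-^ : ∀ {a q} → Prime q → ¬ q ∣ a → ∀ k → Coprime a (q ℕ.^ k)
prime∤⇒coprime-^ q-prime q∤a zero (_ , i∣1) = ℕD.∣1⇒≡1 i∣1
prime∤⇒coprime-^ q-prime q∤a (suc k) =
  coprime-* (Coprimality.sym (prime∤⇒coprime q-prime q∤a)) (prime∤⇒coprime-^ q-prime q∤a k)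

coprime⇒*∣ : ∀ {a b k} → Coprime a b → a ∣ k → b ∣ k → a ℕ.* b ∣ k
coprime⇒*∣ {a} {b} a⊥b a∣k b∣k = subst (_∣ _) lcm≡a*b (lcm-least a∣k b∣k)
  where
  lcm≡a*b : lcm a b ≡ a ℕ.* b
  lcm≡a*b = trans (sym (ℕP.*-identityˡ (lcm a b)))
              (trans (cong (ℕ._* lcm a b) (sym (Coprimality.coprime⇒gcd≡1 a⊥b))) (gcd*lcm a b))

record ExcessPrimePower (a b : ℕ) : Set where
  field
    q f a′ b′ : ℕ
    q-prime : Prime q
    a≡q^f*a′ : a ≡ q ℕ.^ f ℕ.* a′
    b≡b′*q^[1+f] : b ≡ b′ ℕ.* q ℕ.^ suc f
    q∤a′ : ¬ q ∣ a′
    b′>0 : 0 < b′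

private
  ∤⇒1<cofactor : ∀ {a b} → 0 < b → ¬ b ∣ a → 1 < ℕD.quotient (gcd[m,n]∣n a b)
  ∤⇒1<cofactor {a} {b} 0<b b∤a = ℕD.quotient>1 (gcd[m,n]∣n a b) (ℕP.≤∧≢⇒< g≤b g≢b)
    where
    g≤b = ℕD.∣⇒≤ {{ℕ.>-nonZero 0<b}} (gcd[m,n]∣n a b)
    g≢b : gcd a b ≢ b
    g≢b g≡b = b∤a (subst (_∣ a) g≡b (gcd[m,n]∣m a b))

  ∤⇒excessValuation : ∀ {a b} → 0 < a → 0 < b → ¬ b ∣ a →
                      ∃ λ q → Prime q × ∃ λ f → q ℕ.^ f ∣ a × ¬ q ℕ.^ suc f ∣ a × q ℕ.^ suc f ∣ b
  ∤⇒excessValuation {a} {b} 0<a 0<b b∤a with ∃primeDivisor (∤⇒1<cofactor 0<b b∤a)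
  ... | q , q-prime , q∣b′ with valuation (prime>1 q-prime) 0<a | valuation (prime>1 q-prime) 0<b
  ...   | f , q^f∣a , q^[1+f]∤a | e , q^e∣b , q^[1+e]∤b with suc f ℕ.≤? e
  ...     | yes f<e = q , q-prime , f , q^f∣a , q^[1+f]∤a , ℕD.∣-trans (^-monoʳ-∣ q f<e) q^e∣b
  ...     | no f≮e = contradiction q^[1+e]∣b q^[1+e]∤b
    where
    q^e∣gcd : q ℕ.^ e ∣ gcd a b
    q^e∣gcd = gcd-greatest (ℕD.∣-trans (^-monoʳ-∣ q (ℕP.≤-pred (ℕP.≰⇒> f≮e))) q^f∣a) q^e∣b
    q^[1+e]∣b : q ℕ.^ suc e ∣ b
    q^[1+e]∣b = subst (q ℕ.^ suc e ∣_) (sym (ℕD.m∣n⇒n≡quotient*m (gcd[m,n]∣n a b))) (ℕD.*-pres-∣ q∣b′ q^e∣gcd)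

∤⇒excessPrimePower : ∀ {a b} → 0 < a → 0 < b → ¬ b ∣ a → ExcessPrimePower a b
∤⇒excessPrimePower 0<a 0<b b∤a with ∤⇒excessValuation 0<a 0<b b∤a
... | q , q-prime , f , q^f∣a , q^[1+f]∤a , q^[1+f]∣b = record
  { q = q ; f = f ; a′ = ℕD.quotient q^f∣a ; b′ = ℕD.quotient q^[1+f]∣b ; q-prime = q-prime
  ; a≡q^f*a′ = ℕD.m∣n⇒n≡m*quotient q^f∣a
  ; b≡b′*q^[1+f] = ℕD.m∣n⇒n≡quotient*m q^[1+f]∣b
  ; q∤a′ = λ q∣a′ → q^[1+f]∤a (subst₂ _∣_ (ℕP.*-comm _ q) (sym (ℕD.m∣n⇒n≡m*quotient q^f∣a))
                                     (ℕD.*-monoʳ-∣ (q ℕ.^ f) q∣a′))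
  ; b′>0 = ℕ.>-nonZero⁻¹ _ {{ℕD.quotient≢0 q^[1+f]∣b {{ℕ.>-nonZero 0<b}}}}
  }

-- The ring ℤ[√-d]

module QuadraticOrder (d : ℕ) where

  infixl 7 _·_
  infixr 8 _^_

  _·_ : Elt → Elt → Elt
  _·_ = mul d

  _^_ : Elt → ℕ → Elt
  _^_ = pow d

  1ₑ : Elt
  1ₑ = ⟨ 1ℤ , 0ℤ ⟩

  norm : Elt → ℤ
  norm u = re u * re u + + d * (im u * im u)

  conj : Elt → Elt
  conj u = ⟨ re u , - im u ⟩

  det : Elt → Elt → ℤ
  det u v = re u * im v - im u * re v

  scale : ℤ → Elt → Elt
  scale c u = ⟨ c * re u , c * im u ⟩

  private
    D = + d

    ≡ₑ : ∀ {u v} → re u ≡ re v → im u ≡ im v → u ≡ v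
    ≡ₑ = cong₂ ⟨_,_⟩

    comm-re : ∀ D x y x′ y′ → x * x′ - D * (y * y′) ≡ x′ * x - D * (y′ * y)
    comm-re = solve-∀
    comm-im : ∀ (x y x′ y′ : ℤ) → x * y′ + y * x′ ≡ x′ * y + y′ * x
    comm-im = solve-∀
    assoc-re : ∀ D x y x′ y′ x″ y″ →
      (x * x′ - D * (y * y′)) * x″ - D * ((x * y′ + y * x′) * y″)
      ≡ x * (x′ * x″ - D * (y′ * y″)) - D * (y * (x′ * y″ + y′ * x″))
    assoc-re = solve-∀
    assoc-im : ∀ D x y x′ y′ x″ y″ →
      (x * x′ - D * (y * y′)) * y″ + (x * y′ + y * x′) * x″
      ≡ x * (x′ * y″ + y′ * x″) + y * (x′ * x″ - D * (y′ * y″))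
    assoc-im = solve-∀
    identity-re : ∀ D x y → 1ℤ * x - D * (0ℤ * y) ≡ x
    identity-re = solve-∀
    identity-im : ∀ (x y : ℤ) → 1ℤ * y + 0ℤ * x ≡ y
    identity-im = solve-∀
    norm-identity : ∀ D x y x′ y′ →
      (x * x′ - D * (y * y′)) * (x * x′ - D * (y * y′)) + D * ((x * y′ + y * x′) * (x * y′ + y * x′))
      ≡ (x * x + D * (y * y)) * (x′ * x′ + D * (y′ * y′))
    norm-identity = solve-∀
    det-identity : ∀ D x y x′ y′ →
      x * (x * y′ + y * x′) - y * (x * x′ - D * (y * y′)) ≡ (x * x + D * (y * y)) * y′
    det-identity = solve-∀
    scale-re : ∀ D c c′ x y x′ y′ →
      (c * x) * (c′ * x′) - D * ((c * y) * (c′ * y′)) ≡ (c * c′) * (x * x′ - D * (y * y′))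
    scale-re = solve-∀
    scale-im : ∀ (c c′ x y x′ y′ : ℤ) → (c * x) * (c′ * y′) + (c * y) * (c′ * x′) ≡ (c * c′) * (x * y′ + y * x′)
    scale-im = solve-∀

  ·-comm : ∀ u v → u · v ≡ v · u
  ·-comm u v = ≡ₑ (comm-re D (re u) (im u) (re v) (im v)) (comm-im (re u) (im u) (re v) (im v))

  ·-assoc : ∀ u v w → (u · v) · w ≡ u · (v · w)
  ·-assoc u v w = ≡ₑ (assoc-re D (re u) (im u) (re v) (im v) (re w) (im w))
                     (assoc-im D (re u) (im u) (re v) (im v) (re w) (im w))

  ·-identityˡ : ∀ u → 1ₑ · u ≡ u
  ·-identityˡ u = ≡ₑ (identity-re D (re u) (im u)) (identity-im (re u) (im u))

  ·-identityʳ : ∀ u → u · 1ₑ ≡ u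
  ·-identityʳ u = trans (·-comm u 1ₑ) (·-identityˡ u)

  norm-· : ∀ u v → norm (u · v) ≡ norm u * norm v
  norm-· u v = norm-identity D (re u) (im u) (re v) (im v)

  norm-1ₑ : norm 1ₑ ≡ 1ℤ
  norm-1ₑ = trivial D
    where
    trivial : ∀ D → 1ℤ * 1ℤ + D * (0ℤ * 0ℤ) ≡ 1ℤ
    trivial = solve-∀

  det-· : ∀ u v → det u (u · v) ≡ norm u * im v
  det-· u v = det-identity D (re u) (im u) (re v) (im v)

  scale-· : ∀ c c′ u v → scale c u · scale c′ v ≡ scale (c * c′) (u · v)
  scale-· c c′ u v = ≡ₑ (scale-re D c c′ (re u) (im u) (re v) (im v)) (scale-im c c′ (re u) (im u) (re v) (im v))

  ^-distribˡ-+-· : ∀ u i j → u ^ (i ℕ.+ j) ≡ u ^ i · u ^ j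
  ^-distribˡ-+-· u zero j = sym (·-identityˡ _)
  ^-distribˡ-+-· u (suc i) j = trans (cong (u ·_) (^-distribˡ-+-· u i j)) (sym (·-assoc u _ _))

  ·-interchange : ∀ a b c e → (a · b) · (c · e) ≡ (a · c) · (b · e)
  ·-interchange a b c e = begin
    (a · b) · (c · e)   ≡⟨ ·-assoc a b (c · e) ⟩
    a · (b · (c · e))   ≡⟨ cong (a ·_) (·-assoc b c e) ⟨
    a · ((b · c) · e)   ≡⟨ cong (λ z → a · (z · e)) (·-comm b c) ⟩
    a · ((c · b) · e)   ≡⟨ cong (a ·_) (·-assoc c b e) ⟩
    a · (c · (b · e))   ≡⟨ ·-assoc a c (b · e) ⟨
    (a · c) · (b · e)   ∎
    where open ≡-Reasoning

  ^-distribʳ-· : ∀ u v k → (u · v) ^ k ≡ u ^ k · v ^ k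
  ^-distribʳ-· u v zero = sym (·-identityˡ 1ₑ)
  ^-distribʳ-· u v (suc k) = trans (cong ((u · v) ·_) (^-distribʳ-· u v k)) (·-interchange u v _ _)

  ^-*-assoc : ∀ u m k → (u ^ m) ^ k ≡ u ^ (m ℕ.* k)
  ^-*-assoc u m zero = cong (u ^_) (sym (ℕP.*-zeroʳ m))
  ^-*-assoc u m (suc k) = begin
    u ^ m · (u ^ m) ^ k      ≡⟨ cong (u ^ m ·_) (^-*-assoc u m k) ⟩
    u ^ m · u ^ (m ℕ.* k)    ≡⟨ ^-distribˡ-+-· u m (m ℕ.* k) ⟨
    u ^ (m ℕ.+ m ℕ.* k)      ≡⟨ cong (u ^_) (ℕP.*-suc m k) ⟨
    u ^ (m ℕ.* suc k)        ∎
    where open ≡-Reasoning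

  scale-^ : ∀ c u k → scale c u ^ k ≡ scale (c ℤ.^ k) (u ^ k)
  scale-^ c u zero = ≡ₑ (sym (ℤP.*-identityˡ 1ℤ)) (sym (ℤP.*-identityˡ 0ℤ))
  scale-^ c u (suc k) = trans (cong (scale c u ·_) (scale-^ c u k)) (scale-· c (c ℤ.^ k) u (u ^ k))

  -- the coefficients of P_e and Q_e in (t + √-d)ᵉ = P_e(t) + Q_e(t)√-d
  reCoeff imCoeff : ℕ → Poly
  reCoeff zero zero = 1ℤ
  reCoeff zero (suc k) = 0ℤ
  reCoeff (suc e) k = shift (reCoeff e) k + (- D) * imCoeff e k
  imCoeff zero k = 0ℤ
  imCoeff (suc e) k = reCoeff e k + shift (imCoeff e) k

  reCoeff-deg : ∀ e k → e < k → reCoeff e k ≡ 0ℤ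
  imCoeff-deg : ∀ e k → e ≤ k → imCoeff e k ≡ 0ℤ
  reCoeff-deg zero (suc k) _ = refl
  reCoeff-deg (suc e) (suc k) (s≤s e<k) =
    trans (cong₂ (λ a b → a + (- D) * b) (reCoeff-deg e k e<k) (imCoeff-deg e (suc k) (ℕP.m≤n⇒m≤1+n (ℕP.<⇒≤ e<k))))
          (trans (ℤP.+-identityˡ _) (ℤP.*-zeroʳ (- D)))
  imCoeff-deg zero k _ = refl
  imCoeff-deg (suc e) (suc k) (s≤s e≤k) =
    cong₂ _+_ (reCoeff-deg e (suc k) (s≤s e≤k)) (imCoeff-deg e k e≤k)

  reCoeff-leading : ∀ e → reCoeff e e ≡ 1ℤ
  reCoeff-leading zero = refl
  reCoeff-leading (suc e) =
    trans (cong₂ (λ a b → a + (- D) * b) (reCoeff-leading e) (imCoeff-deg e (suc e) (ℕP.n≤1+n e)))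
          (cong (λ z → 1ℤ + z) (ℤP.*-zeroʳ (- D)))

  imCoeff-leading : ∀ e → imCoeff (suc e) e ≡ + suc e
  imCoeff-leading zero = refl
  imCoeff-leading (suc e) = cong₂ _+_ (reCoeff-leading (suc e)) (imCoeff-leading e)

  t+√-d : ℤ → Elt
  t+√-d t = ⟨ t , 1ℤ ⟩

  t+√-d^-eval : ∀ e t → re (t+√-d t ^ e) ≡ eval (suc e) (reCoeff e) t
                      × im (t+√-d t ^ e) ≡ eval e (imCoeff e) t
  t+√-d^-eval zero t = sym (cong (λ z → 1ℤ + z) (ℤP.*-zeroʳ t)) , refl
  t+√-d^-eval (suc e) t = re-step , im-step
    where
    open ≡-Reasoning
    x = re (t+√-d t ^ e)
    y = im (t+√-d t ^ e)
    ih = t+√-d^-eval e t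
    re-form : ∀ D t x y → t * x - D * (1ℤ * y) ≡ t * x + (- D) * y
    re-form = solve-∀
    im-form : ∀ (t x y : ℤ) → t * y + 1ℤ * x ≡ x + t * y
    im-form = solve-∀
    re-step : t * x - D * (1ℤ * y) ≡ eval (suc (suc e)) (reCoeff (suc e)) t
    re-step = begin
      t * x - D * (1ℤ * y)                                             ≡⟨ re-form D t x y ⟩
      t * x + (- D) * y                                                ≡⟨ cong₂ (λ a b → t * a + (- D) * b) (proj₁ ih) (proj₂ ih) ⟩
      t * eval (suc e) (reCoeff e) t + (- D) * eval e (imCoeff e) t    ≡⟨ cong (λ z → t * eval (suc e) (reCoeff e) t + (- D) * z)
                                                                            (trans (eval-dropLast (suc e) (imCoeff e) t (imCoeff-deg e (suc e) (ℕP.n≤1+n e)))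
                                                                                   (eval-dropLast e (imCoeff e) t (imCoeff-deg e e ℕP.≤-refl))) ⟨
      t * eval (suc e) (reCoeff e) t + (- D) * eval (suc (suc e)) (imCoeff e) t
                                                                       ≡⟨ cong₂ _+_ (eval-shift (suc e) (reCoeff e) t) (eval-* (suc (suc e)) (- D) (imCoeff e) t) ⟨
      eval (suc (suc e)) (shift (reCoeff e)) t + eval (suc (suc e)) (λ k → (- D) * imCoeff e k) t
                                                                       ≡⟨ eval-+ (suc (suc e)) (shift (reCoeff e)) (λ k → (- D) * imCoeff e k) t ⟨
      eval (suc (suc e)) (reCoeff (suc e)) t                           ∎
    im-step : t * y + 1ℤ * x ≡ eval (suc e) (imCoeff (suc e)) t
    im-step = begin
      t * y + 1ℤ * x                                                   ≡⟨ im-form t x y ⟩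
      x + t * y                                                        ≡⟨ cong₂ (λ a b → a + t * b) (proj₁ ih) (proj₂ ih) ⟩
      eval (suc e) (reCoeff e) t + t * eval e (imCoeff e) t            ≡⟨ cong (λ z → eval (suc e) (reCoeff e) t + z) (eval-shift e (imCoeff e) t) ⟨
      eval (suc e) (reCoeff e) t + eval (suc e) (shift (imCoeff e)) t  ≡⟨ eval-+ (suc e) (reCoeff e) (shift (imCoeff e)) t ⟨
      eval (suc e) (imCoeff (suc e)) t                                 ∎

-- ℤ[√-d] modulo an inert odd prime

module InertPrime (d p : ℕ) (p-prime : Prime p) (p-odd : ¬ 2 ∣ p) (inert : InertOdd d p) where

  open QuadraticOrder d

  instance
    p≢0 : ℕ.NonZero p
    p≢0 = prime⇒nonZero p-prime

  infix 4 _∈𝔽ₚ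

  record Unit (u : Elt) : Set where
    constructor mkUnit
    field p∤norm : ¬ + p ∣ˢ norm u
  open Unit public

  -- u reduces into 𝔽ₚ ⊂ 𝔽_{p²}; for units these form the trivial class of ℤ_{L,p}^×/Γ⁰_{L,p}.
  _∈𝔽ₚ : Elt → Set
  u ∈𝔽ₚ = + p ∣ˢ im u

  Unit-· : ∀ {u v} → Unit u → Unit v → Unit (u · v)
  Unit-· {u} {v} (mkUnit p∤Nu) (mkUnit p∤Nv) = mkUnit λ p∣N[uv] →
    [ p∤Nu , p∤Nv ]′ (euclidsLemmaℤ p-prime (norm u) (norm v) (subst (+ p ∣ˢ_) (norm-· u v) p∣N[uv]))

  Unit-1ₑ : Unit 1ₑ
  Unit-1ₑ = mkUnit (prime∤1 p-prime ∘ subst (+ p ∣ˢ_) norm-1ₑ)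

  Unit-^ : ∀ {u} → Unit u → ∀ k → Unit (u ^ k)
  Unit-^ unit-u zero = Unit-1ₑ
  Unit-^ unit-u (suc k) = Unit-· unit-u (Unit-^ unit-u k)

  private
    norm-times-y′² : ∀ (D x y y′ : ℤ) → (x * y′) * (x * y′) + D
      ≡ (y′ * y′) * (x * x + D * (y * y)) - D * ((y * y′ - 1ℤ) * (y * y′ + 1ℤ))
    norm-times-y′² = solve-∀
    norm-minus-y² : ∀ (D x y : ℤ) → x * x ≡ (x * x + D * (y * y)) - D * (y * y)
    norm-minus-y² = solve-∀

  -- A non-unit with p ∤ y would make -d ≡ (x/y)² a square mod p.
  isUnit⇒p∤norm : ∀ u → IsUnit p u → ¬ + p ∣ˢ norm u
  isUnit⇒p∤norm u isUnit-u p∣N with + p ℤD.∣? im u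
  ... | yes p∣y = isUnit-u (∣⇒∣ᵤ ([ id , id ]′ (euclidsLemmaℤ p-prime (re u) (re u) p∣x²)) , ∣⇒∣ᵤ p∣y)
    where
    p∣x² : + p ∣ˢ re u * re u
    p∣x² = subst (+ p ∣ˢ_) (sym (norm-minus-y² (+ d) (re u) (im u)))
             (ℤD.∣m∣n⇒∣m-n p∣N (ℤD.∣n⇒∣m*n (+ d) (ℤD.∣m⇒∣m*n (im u) p∣y)))
  ... | no p∤y with inverse-mod p-prime (im u) p∤y
  ...   | y′ , p∣yy′-1 = proj₂ inert (re u * y′ , ∣⇒∣ᵤ p∣[xy′]²+d)
    where
    p∣[xy′]²+d : + p ∣ˢ (re u * y′) * (re u * y′) + + d
    p∣[xy′]²+d = subst (+ p ∣ˢ_) (sym (norm-times-y′² (+ d) (re u) (im u) y′))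
                   (ℤD.∣m∣n⇒∣m-n (ℤD.∣n⇒∣m*n (y′ * y′) p∣N) (ℤD.∣n⇒∣m*n (+ d) (ℤD.∣m⇒∣m*n _ p∣yy′-1)))

  isUnit⇒Unit : ∀ u → IsUnit p u → Unit u
  isUnit⇒Unit u = mkUnit ∘ isUnit⇒p∤norm u

  Unit⇒isUnit : ∀ u → Unit u → IsUnit p u
  Unit⇒isUnit u (mkUnit p∤N) (p∣x , p∣y) =
    p∤N (ℤD.∣m∣n⇒∣m+n (ℤD.∣m⇒∣m*n (re u) (∣ᵤ⇒∣ {i = re u} p∣x)) (ℤD.∣n⇒∣m*n (+ d) (ℤD.∣m⇒∣m*n (im u) (∣ᵤ⇒∣ {i = im u} p∣y))))

  ∈𝔽ₚ-· : ∀ {a b} → a ∈𝔽ₚ → b ∈𝔽ₚ → a · b ∈𝔽ₚ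
  ∈𝔽ₚ-· {a} {b} p∣a p∣b = ℤD.∣m∣n⇒∣m+n (ℤD.∣n⇒∣m*n (re a) p∣b) (ℤD.∣m⇒∣m*n (re b) p∣a)

  ∈𝔽ₚ-cancel : ∀ {a b} → Unit a → a ∈𝔽ₚ → a · b ∈𝔽ₚ → b ∈𝔽ₚ
  ∈𝔽ₚ-cancel {a} {b} (mkUnit p∤Na) p∣a p∣ab = [ flip contradiction p∤Na , id ]′
    (euclidsLemmaℤ p-prime (norm a) (im b) (subst (+ p ∣ˢ_) (det-· a b)
      (ℤD.∣m∣n⇒∣m-n (ℤD.∣n⇒∣m*n (re a) p∣ab) (ℤD.∣m⇒∣m*n (re (a · b)) p∣a))))

  ^∈𝔽ₚ-+ : ∀ u i j → u ^ i ∈𝔽ₚ → u ^ j ∈𝔽ₚ → u ^ (i ℕ.+ j) ∈𝔽ₚ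
  ^∈𝔽ₚ-+ u i j p∣i p∣j = subst _∈𝔽ₚ (sym (^-distribˡ-+-· u i j)) (∈𝔽ₚ-· {u ^ i} {u ^ j} p∣i p∣j)

  ^∈𝔽ₚ-cancel : ∀ {u} i j → Unit u → u ^ i ∈𝔽ₚ → u ^ (i ℕ.+ j) ∈𝔽ₚ → u ^ j ∈𝔽ₚ
  ^∈𝔽ₚ-cancel {u} i j unit-u p∣i p∣i+j =
    ∈𝔽ₚ-cancel {u ^ i} {u ^ j} (Unit-^ unit-u i) p∣i (subst _∈𝔽ₚ (^-distribˡ-+-· u i j) p∣i+j)

  ^∈𝔽ₚ-* : ∀ u o q → u ^ o ∈𝔽ₚ → u ^ (q ℕ.* o) ∈𝔽ₚ
  ^∈𝔽ₚ-* u o zero _ = ∣0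
  ^∈𝔽ₚ-* u o (suc q) p∣o = ^∈𝔽ₚ-+ u o (q ℕ.* o) p∣o (^∈𝔽ₚ-* u o q p∣o)

  _∈𝔽ₚ? : ∀ u → Dec (u ∈𝔽ₚ)
  u ∈𝔽ₚ? = + p ℤD.∣? im u

  -- the order of the class of u in ℤ_{L,p}^×/Γ⁰_{L,p}
  Order : Elt → ℕ → Set
  Order u o = 0 < o × u ^ o ∈𝔽ₚ × (∀ k → u ^ k ∈𝔽ₚ → o ∣ k)

  order⇒^∈𝔽ₚ : ∀ {u o} → Order u o → ∀ k → o ∣ k → u ^ k ∈𝔽ₚ
  order⇒^∈𝔽ₚ {u} {o} (_ , p∣o , _) k (ℕD.divides q refl) = ^∈𝔽ₚ-* u o q p∣o

  order-unique : ∀ {u o o′} → Order u o → Order u o′ → o ≡ o′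
  order-unique (_ , p∣o , o∣) (_ , p∣o′ , o′∣) = ℕD.∣-antisym (o∣ _ p∣o′) (o′∣ _ p∣o)

  order-exists : ∀ {u} → Unit u → ∀ {m} → 0 < m → u ^ m ∈𝔽ₚ → ∃ λ o → Order u o × o ≤ m
  order-exists {u} unit-u 0<m p∣m with leastPositive (λ k → (u ^ k) ∈𝔽ₚ?) 0<m p∣m
  ... | o , 0<o , o≤m , p∣o , minimal = o , (0<o , p∣o , o∣) , o≤m
    where
    instance _ = ℕ.>-nonZero 0<o
    o∣ : ∀ k → u ^ k ∈𝔽ₚ → o ∣ k
    o∣ k p∣k with k % o ℕ.≟ 0
    ... | yes k%o≡0 = ℕD.m%n≡0⇒n∣m k o k%o≡0
    ... | no k%o≢0 = contradiction remainder∈𝔽ₚ (minimal (k % o) (ℕP.n≢0⇒n>0 k%o≢0) (m%n<n k o))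
      where
      remainder∈𝔽ₚ : u ^ (k % o) ∈𝔽ₚ
      remainder∈𝔽ₚ = ^∈𝔽ₚ-cancel ((k / o) ℕ.* o) (k % o) unit-u (^∈𝔽ₚ-* u o (k / o) p∣o)
        (subst (λ n → u ^ n ∈𝔽ₚ) (trans (m≡m%n+[m/n]*n k o) (ℕP.+-comm (k % o) _)) p∣k)

  order-^ : ∀ {u m a} → Order u (m ℕ.* a) → 0 < m → Order (u ^ m) a
  order-^ {u} {m} {a} (0<ma , p∣ma , ma∣) 0<m =
    ℕP.n≢0⇒n>0 a≢0 ,
    subst _∈𝔽ₚ (sym (^-*-assoc u m a)) p∣ma ,
    λ k p∣k → ℕD.*-cancelˡ-∣ m {{ℕ.>-nonZero 0<m}} (ma∣ (m ℕ.* k) (subst _∈𝔽ₚ (^-*-assoc u m k) p∣k))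
    where
    a≢0 : a ≢ 0
    a≢0 refl = ℕP.<-irrefl (sym (ℕP.*-zeroʳ m)) 0<ma

  private
    order-·-∣ʳ : ∀ {u v a b} → Unit u → Order u a → Order v b → Coprime a b →
                 ∀ k → (u · v) ^ k ∈𝔽ₚ → b ∣ k
    order-·-∣ʳ {u} {v} {a} {b} unit-u order-u (_ , _ , b∣) a⊥b k p∣k =
      coprime-divisor (Coprimality.sym a⊥b) (b∣ (a ℕ.* k) (∈𝔽ₚ-cancel {u ^ (a ℕ.* k)} {v ^ (a ℕ.* k)}
        (Unit-^ unit-u (a ℕ.* k)) (order⇒^∈𝔽ₚ order-u (a ℕ.* k) (ℕD.m∣m*n k))
        (subst _∈𝔽ₚ (^-distribʳ-· u v (a ℕ.* k)) (^∈𝔽ₚ-* (u · v) k a p∣k))))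

  order-· : ∀ {u v a b} → Unit u → Unit v → Order u a → Order v b → Coprime a b → Order (u · v) (a ℕ.* b)
  order-· {u} {v} {a} {b} unit-u unit-v order-u@(0<a , _ , _) order-v@(0<b , _ , _) a⊥b =
    ℕP.*-mono-< 0<a 0<b , p∣ab , λ k p∣k → coprime⇒*∣ a⊥b (a∣ k p∣k) (order-·-∣ʳ unit-u order-u order-v a⊥b k p∣k)
    where
    p∣ab : (u · v) ^ (a ℕ.* b) ∈𝔽ₚ
    p∣ab = subst _∈𝔽ₚ (sym (^-distribʳ-· u v (a ℕ.* b)))
             (∈𝔽ₚ-· {u ^ (a ℕ.* b)} {v ^ (a ℕ.* b)}
               (order⇒^∈𝔽ₚ order-u _ (ℕD.m∣m*n b)) (order⇒^∈𝔽ₚ order-v _ (ℕD.n∣m*n a)))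
    a∣ : ∀ k → (u · v) ^ k ∈𝔽ₚ → a ∣ k
    a∣ k p∣k = order-·-∣ʳ unit-v order-v order-u (Coprimality.sym a⊥b) k (subst (λ w → w ^ k ∈𝔽ₚ) (·-comm u v) p∣k)

  private
    slope : ∀ u → ¬ u ∈𝔽ₚ → ℤ
    slope u p∤y = re u * proj₁ (inverse-mod p-prime (im u) p∤y)

    slopeIndex′ : ∀ u → Dec (u ∈𝔽ₚ) → Fin (suc p)
    slopeIndex′ u (yes _) = fromℕ p
    slopeIndex′ u (no p∤y) = fromℕ< (ℕP.m<n⇒m<1+n (n%ℕd<d (slope u p∤y) p))

    fromℕ≢fromℕ< : ∀ {m} (m<p : m < p) → fromℕ p ≢ fromℕ< (ℕP.m<n⇒m<1+n m<p)
    fromℕ≢fromℕ< m<p eq =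
      ℕP.<-irrefl (trans (sym (Fin.toℕ-fromℕ< _)) (trans (cong toℕ (sym eq)) (Fin.toℕ-fromℕ p))) m<p

    det-decomposition : ∀ x y x′ y′ s s′ → x * y′ - y * x′ ≡ y′ * (x - s * y) - y * (x′ - s′ * y′) + y * y′ * (s - s′)
    det-decomposition = solve-∀
    x-slope*y : ∀ x y y⁻¹ → x - x * y⁻¹ * y ≡ - (x * (y * y⁻¹ - 1ℤ))
    x-slope*y = solve-∀

    p∣x-slope*y : ∀ u p∤y → + p ∣ˢ re u - slope u p∤y * im u
    p∣x-slope*y u p∤y = subst (+ p ∣ˢ_) (sym (x-slope*y (re u) (im u) _))
      (ℤD.∣m⇒∣-m (ℤD.∣n⇒∣m*n (re u) (proj₂ (inverse-mod p-prime (im u) p∤y))))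

    slopeIndex′-≡⇒p∣det : ∀ u v du dv → slopeIndex′ u du ≡ slopeIndex′ v dv → + p ∣ˢ det u v
    slopeIndex′-≡⇒p∣det u v (yes p∣y) (yes p∣y′) _ =
      ℤD.∣m∣n⇒∣m-n (ℤD.∣n⇒∣m*n (re u) p∣y′) (ℤD.∣m⇒∣m*n (re v) p∣y)
    slopeIndex′-≡⇒p∣det u v (yes _) (no p∤y′) eq =
      contradiction eq (fromℕ≢fromℕ< (n%ℕd<d (slope v p∤y′) p))
    slopeIndex′-≡⇒p∣det u v (no p∤y) (yes _) eq =
      contradiction (sym eq) (fromℕ≢fromℕ< (n%ℕd<d (slope u p∤y) p))
    slopeIndex′-≡⇒p∣det u v (no p∤y) (no p∤y′) eq =
      subst (+ p ∣ˢ_) (sym (det-decomposition (re u) (im u) (re v) (im v) (slope u p∤y) (slope v p∤y′)))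
        (ℤD.∣m∣n⇒∣m+n (ℤD.∣m∣n⇒∣m-n (ℤD.∣n⇒∣m*n (im v) (p∣x-slope*y u p∤y)) (ℤD.∣n⇒∣m*n (im u) (p∣x-slope*y v p∤y′)))
                       (ℤD.∣n⇒∣m*n (im u * im v) (%ℕ≡⇒∣- (slope u p∤y) (slope v p∤y′) slopes≡)))
      where
      slopes≡ = trans (sym (Fin.toℕ-fromℕ< _)) (trans (cong toℕ eq) (Fin.toℕ-fromℕ< _))

  -- the point [x : y] of the projective line ℙ¹(𝔽ₚ), with p + 1 possible values
  slopeIndex : Elt → Fin (suc p)
  slopeIndex u = slopeIndex′ u (u ∈𝔽ₚ?)

  slopeIndex-≡⇒p∣det : ∀ u v → slopeIndex u ≡ slopeIndex v → + p ∣ˢ det u v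
  slopeIndex-≡⇒p∣det u v = slopeIndex′-≡⇒p∣det u v (u ∈𝔽ₚ?) (v ∈𝔽ₚ?)

  collision : (h : ℕ → Elt) → ∃₂ λ i j → i < j × j ≤ suc p × + p ∣ˢ det (h i) (h j)
  collision h with Fin.pigeonhole (ℕP.n<1+n (suc p)) (slopeIndex ∘ h ∘ toℕ)
  ... | i , j , i<j , same = toℕ i , toℕ j , i<j , ℕP.≤-pred (Fin.toℕ<n j) , slopeIndex-≡⇒p∣det _ _ same

  det-^⇒^∈𝔽ₚ : ∀ {x} → Unit x → ∀ {i j} → i < j → + p ∣ˢ det (x ^ i) (x ^ j) → x ^ (j ℕ.∸ i) ∈𝔽ₚ
  det-^⇒^∈𝔽ₚ {x} unit-x {i} {j} i<j p∣det =
    [ flip contradiction (p∤norm (Unit-^ unit-x i)) , id ]′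
      (euclidsLemmaℤ p-prime (norm (x ^ i)) (im (x ^ (j ℕ.∸ i)))
        (subst (+ p ∣ˢ_) (det-· (x ^ i) (x ^ (j ℕ.∸ i))) (subst (λ w → + p ∣ˢ det (x ^ i) w) x^j≡ p∣det)))
    where
    x^j≡ : x ^ j ≡ x ^ i · x ^ (j ℕ.∸ i)
    x^j≡ = trans (cong (x ^_) (sym (ℕP.m+[n∸m]≡n (ℕP.<⇒≤ i<j)))) (^-distribˡ-+-· x i (j ℕ.∸ i))

  ∃order≤1+p : ∀ {x} → Unit x → ∃ λ o → Order x o × o ≤ suc p
  ∃order≤1+p {x} unit-x = fromCollision (collision (x ^_))
    where
    fromCollision : (∃₂ λ i j → i < j × j ≤ suc p × + p ∣ˢ det (x ^ i) (x ^ j)) → ∃ λ o → Order x o × o ≤ suc p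
    fromCollision (i , j , i<j , j≤1+p , p∣det) =
      let o , order , o≤j∸i = order-exists unit-x (ℕP.m<n⇒0<n∸m i<j) (det-^⇒^∈𝔽ₚ unit-x i<j p∣det)
      in o , order , ℕP.≤-trans o≤j∸i (ℕP.≤-trans (ℕP.m∸n≤m j i) j≤1+p)

  private
    re-residue : ∀ D x y x′ y′ c → x′ - (x * (c * (x * x′ - D * (- y * y′))) - D * (y * (c * (x * y′ + - y * x′))))
                 ≡ - (x′ * ((x * x + D * (y * y)) * c - 1ℤ))
    re-residue = solve-∀
    im-residue : ∀ D x y x′ y′ c → y′ - (x * (c * (x * y′ + - y * x′)) + y * (c * (x * x′ - D * (- y * y′))))
                 ≡ - (y′ * ((x * x + D * (y * y)) * c - 1ℤ))
    im-residue = solve-∀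
    det-conj : ∀ x y x′ y′ c → c * (x * y′ - y * x′) ≡ c * (x * y′ + - y * x′)
    det-conj = solve-∀
    add-back : ∀ a b → (a - b) + b ≡ a
    add-back = solve-∀

  -- The quotient g = conj(u)·v / N(u) lies in Γ⁰ exactly because det u v ≡ 0 mod p.
  det⇒sameClass : ∀ {u v} → Unit u → Unit v → + p ∣ˢ det u v → SameClass d p v u
  det⇒sameClass {u} {v} unit-u unit-v p∣det =
    g , (isUnit-g , ∣⇒∣ᵤ p∣im-g) , ∣⇒∣ᵤ p∣re-diff , ∣⇒∣ᵤ p∣im-diff
    where
    N⁻¹ = proj₁ (inverse-mod p-prime (norm u) (p∤norm unit-u))
    p∣NN⁻¹-1 = proj₂ (inverse-mod p-prime (norm u) (p∤norm unit-u))
    g : Elt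
    g = scale N⁻¹ (conj u · v)
    p∣im-g : + p ∣ˢ im g
    p∣im-g = subst (+ p ∣ˢ_) (det-conj (re u) (im u) (re v) (im v) N⁻¹) (ℤD.∣n⇒∣m*n N⁻¹ p∣det)
    p∣re-diff : + p ∣ˢ re v - re (u · g)
    p∣re-diff = subst (+ p ∣ˢ_) (sym (re-residue (+ d) (re u) (im u) (re v) (im v) N⁻¹))
                  (ℤD.∣m⇒∣-m (ℤD.∣n⇒∣m*n (re v) p∣NN⁻¹-1))
    p∣im-diff : + p ∣ˢ im v - im (u · g)
    p∣im-diff = subst (+ p ∣ˢ_) (sym (im-residue (+ d) (re u) (im u) (re v) (im v) N⁻¹))
                  (ℤD.∣m⇒∣-m (ℤD.∣n⇒∣m*n (im v) p∣NN⁻¹-1))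
    isUnit-g : IsUnit p g
    isUnit-g (p∣x , p∣y) = Unit⇒isUnit v unit-v
      ( ∣⇒∣ᵤ (subst (+ p ∣ˢ_) (add-back (re v) (re (u · g))) (ℤD.∣m∣n⇒∣m+n p∣re-diff p∣re[ug]))
      , ∣⇒∣ᵤ (subst (+ p ∣ˢ_) (add-back (im v) (im (u · g))) (ℤD.∣m∣n⇒∣m+n p∣im-diff p∣im[ug])) )
      where
      p∣re-g : + p ∣ˢ re g
      p∣re-g = ∣ᵤ⇒∣ {i = re g} p∣x
      p∣im-g′ : + p ∣ˢ im g
      p∣im-g′ = ∣ᵤ⇒∣ {i = im g} p∣y
      p∣re[ug] : + p ∣ˢ re (u · g)
      p∣re[ug] = ℤD.∣m∣n⇒∣m-n (ℤD.∣n⇒∣m*n (re u) p∣re-g) (ℤD.∣n⇒∣m*n (+ d) (ℤD.∣n⇒∣m*n (im u) p∣im-g′))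
      p∣im[ug] : + p ∣ˢ im (u · g)
      p∣im[ug] = ℤD.∣m∣n⇒∣m+n (ℤD.∣n⇒∣m*n (re u) p∣im-g′) (ℤD.∣n⇒∣m*n (im u) p∣re-g)

  Primitive : Elt → Set
  Primitive α = ∀ m → 0 < m → m ≤ p → ¬ α ^ m ∈𝔽ₚ

  -- Among u, α⁰, …, αᵖ two share a point of ℙ¹(𝔽ₚ); primitivity rules out two powers.
  primitive⇒generates : ∀ {α} → Unit α → Primitive α → Generates d p α
  primitive⇒generates {α} unit-α α-primitive u isUnit-u = fromCollision (collision sequence)
    where
    sequence : ℕ → Elt
    sequence zero = u
    sequence (suc n) = α ^ n
    fromCollision : (∃₂ λ i j → i < j × j ≤ suc p × + p ∣ˢ det (sequence i) (sequence j)) →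
                    ∃ λ k → SameClass d p (α ^ k) u
    fromCollision (zero , suc j , _ , _ , p∣det) = j , det⇒sameClass (isUnit⇒Unit u isUnit-u) (Unit-^ unit-α j) p∣det
    fromCollision (suc i , suc j , s≤s i<j , s≤s j≤p , p∣det) =
      contradiction (det-^⇒^∈𝔽ₚ unit-α i<j p∣det)
                    (α-primitive (j ℕ.∸ i) (ℕP.m<n⇒0<n∸m i<j) (ℕP.≤-trans (ℕP.m∸n≤m j i) j≤p))

  √-d : Elt
  √-d = ⟨ 0ℤ , 1ℤ ⟩

  private
    norm-√-d : ∀ D → 0ℤ * 0ℤ + D * (1ℤ * 1ℤ) ≡ D
    norm-√-d = solve-∀
    norm-t+√-d : ∀ D t → t * t + D * (1ℤ * 1ℤ) ≡ t * t + D
    norm-t+√-d = solve-∀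

  Unit-√-d : Unit √-d
  Unit-√-d = mkUnit λ p∣N → proj₁ inert (∣⇒∣ᵤ {i = + d} (subst (+ p ∣ˢ_) (norm-√-d (+ d)) p∣N))

  Unit-t+√-d : ∀ t → Unit (t+√-d t)
  Unit-t+√-d t = mkUnit λ p∣N → proj₂ inert (t , ∣⇒∣ᵤ (subst (+ p ∣ˢ_) (norm-t+√-d (+ d) t) p∣N))

  √-d^odd∉𝔽ₚ : ∀ k → ¬ √-d ^ suc (k ℕ.* 2) ∈𝔽ₚ
  √-d^odd∉𝔽ₚ k p∣odd = prime∤1 p-prime
    (∈𝔽ₚ-cancel (Unit-^ Unit-√-d (k ℕ.* 2)) (^∈𝔽ₚ-* √-d 2 k √-d^2∈𝔽ₚ)
      (subst _∈𝔽ₚ (·-comm √-d (√-d ^ (k ℕ.* 2))) p∣odd))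
    where
    √-d^2∈𝔽ₚ : √-d ^ 2 ∈𝔽ₚ
    √-d^2∈𝔽ₚ = subst (λ w → + p ∣ˢ im (√-d · w)) (sym (·-identityʳ √-d)) (subst (+ p ∣ˢ_) (sym (vanish (+ d))) ∣0)
      where
      vanish : ∀ (D : ℤ) → 0ℤ * 1ℤ + 1ℤ * 0ℤ ≡ 0ℤ
      vanish = solve-∀

  -- im((t + √-d)^(e+1)) is a polynomial in t of degree e with leading coefficient e + 1 ≢ 0,
  -- so it cannot vanish at the e + 1 points 0, …, e.
  t+√-d-powers-not-all-scalar : ∀ e → suc e < p → ¬ (∀ t → t < suc e → t+√-d (+ t) ^ suc e ∈𝔽ₚ)
  t+√-d-powers-not-all-scalar e 1+e<p all∈𝔽ₚ = ℕP.<-irrefl refl (ℕP.<-≤-trans 1+e<p (ℕD.∣⇒≤ p∣1+e))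
    where
    roots : All (λ r → + p ∣ˢ eval (suc e) (imCoeff (suc e)) r) (naturals (suc e))
    roots = naturals-all (suc e) λ t t<1+e → subst (+ p ∣ˢ_) (proj₂ (t+√-d^-eval (suc e) (+ t))) (all∈𝔽ₚ t t<1+e)
    p∣1+e : p ∣ suc e
    p∣1+e = ∣⇒∣ᵤ {i = + suc e} (subst (+ p ∣ˢ_) (imCoeff-leading e)
      (roots⇒∣coefficients p-prime (suc e) (imCoeff (suc e)) (naturals-incongruent (suc e) (ℕP.<⇒≤ 1+e<p)) roots e ℕP.≤-refl))

  ∃nonScalarPower : ∀ {a} → 0 < a → a ≤ p → ∃ λ x → Unit x × ¬ x ^ a ∈𝔽ₚ
  ∃nonScalarPower {suc e} _ 1+e≤p with suc e ℕ.≟ p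
  ... | yes refl = let k , p≡2k+1 = odd⇒≡suc[k*2] p-odd in
                   √-d , Unit-√-d , subst (λ n → ¬ √-d ^ n ∈𝔽ₚ) (sym p≡2k+1) (√-d^odd∉𝔽ₚ k)
  ... | no 1+e≢p with all<⊎counterexample (λ t → (t+√-d (+ t) ^ suc e) ∈𝔽ₚ?) (suc e)
  ...   | inj₂ (t , _ , ∉𝔽ₚ) = t+√-d (+ t) , Unit-t+√-d (+ t) , ∉𝔽ₚ
  ...   | inj₁ all∈𝔽ₚ = ⊥-elim (t+√-d-powers-not-all-scalar e (ℕP.≤∧≢⇒< 1+e≤p 1+e≢p) all∈𝔽ₚ)

  order≤1+p : ∀ {z a} → Unit z → Order z a → a ≤ suc p
  order≤1+p unit-z order-z = let o , order-z′ , o≤1+p = ∃order≤1+p unit-z in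
    subst (_≤ suc p) (order-unique order-z′ order-z) o≤1+p

  -- Some prime q divides the order of x to a higher power q^(f+1) than the order q^f·a′ of α;
  -- α^(q^f) · x^b′ then has order a′·q^(f+1) > a.
  order-step : ∀ {α a x} → Unit α → Order α a → Unit x → ¬ x ^ a ∈𝔽ₚ →
               ∃₂ λ z a′ → Unit z × Order z a′ × a < a′
  order-step {α} {a} {x} unit-α order-α unit-x x^a∉𝔽ₚ = fromOrder (∃order≤1+p unit-x)
    where
    fromOrder : (∃ λ b → Order x b × b ≤ suc p) → ∃₂ λ z a′ → Unit z × Order z a′ × a < a′
    fromOrder (b , order-x , _) =
      fromExcess (∤⇒excessPrimePower (proj₁ order-α) (proj₁ order-x) (x^a∉𝔽ₚ ∘ order⇒^∈𝔽ₚ order-x a))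
      where
      fromExcess : ExcessPrimePower a b → ∃₂ λ z a′ → Unit z × Order z a′ × a < a′
      fromExcess excess = α ^ (q ℕ.^ f) · x ^ b′ , a′ ℕ.* q ℕ.^ suc f , unit-z , order-z , a<a′*q^[1+f]
        where
        open ExcessPrimePower excess
        unit-z : Unit (α ^ (q ℕ.^ f) · x ^ b′)
        unit-z = Unit-· (Unit-^ unit-α (q ℕ.^ f)) (Unit-^ unit-x b′)
        1<q = prime>1 q-prime
        order-α′ : Order (α ^ (q ℕ.^ f)) a′
        order-α′ = order-^ {α} {q ℕ.^ f} {a′} (subst (Order α) a≡q^f*a′ order-α)
                     (ℕP.m^n>0 q {{ℕ.>-nonZero (ℕP.<-trans (s≤s z≤n) 1<q)}} f)
        order-x′ : Order (x ^ b′) (q ℕ.^ suc f)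
        order-x′ = order-^ {x} {b′} {q ℕ.^ suc f} (subst (Order x) b≡b′*q^[1+f] order-x) b′>0
        order-z : Order (α ^ (q ℕ.^ f) · x ^ b′) (a′ ℕ.* q ℕ.^ suc f)
        order-z = order-· {α ^ (q ℕ.^ f)} {x ^ b′} {a′} {q ℕ.^ suc f} (Unit-^ unit-α (q ℕ.^ f)) (Unit-^ unit-x b′)
                    order-α′ order-x′ (prime∤⇒coprime-^ q-prime q∤a′ (suc f))
        a<a′*q^[1+f] : a < a′ ℕ.* q ℕ.^ suc f
        a<a′*q^[1+f] = begin-strict
          a                            <⟨ ℕP.m<m*n a q {{ℕ.>-nonZero (proj₁ order-α)}} 1<q ⟩
          a ℕ.* q                      ≡⟨ cong (ℕ._* q) a≡q^f*a′ ⟩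
          q ℕ.^ f ℕ.* a′ ℕ.* q         ≡⟨ rearrange (q ℕ.^ f) a′ q ⟩
          a′ ℕ.* (q ℕ.* q ℕ.^ f)       ∎
          where
          open ℕP.≤-Reasoning
          rearrange : ∀ Q a′ q → Q ℕ.* a′ ℕ.* q ≡ a′ ℕ.* (q ℕ.* Q)
          rearrange = ℕSolver.solve-∀

  order≥1+p⇒primitive : ∀ {α a} → Order α a → suc p ≤ a → Primitive α
  order≥1+p⇒primitive (_ , _ , a∣) 1+p≤a m 0<m m≤p α^m∈𝔽ₚ =
    ℕP.<-irrefl refl (ℕP.<-≤-trans (ℕP.<-≤-trans (s≤s m≤p) 1+p≤a) (ℕD.∣⇒≤ {{ℕ.>-nonZero 0<m}} (a∣ m α^m∈𝔽ₚ)))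

  private
    primitive-from : ∀ n {α a} → Unit α → Order α a → suc p ℕ.∸ a ≤ n → ∃ λ γ → Unit γ × Primitive γ
    primitive-from n {α} {a} unit-α order-α fuel with suc p ℕ.≤? a
    ... | yes 1+p≤a = α , unit-α , order≥1+p⇒primitive order-α 1+p≤a
    primitive-from zero unit-α order-α fuel | no 1+p≰a =
      contradiction (ℕP.m∸n≡0⇒m≤n (ℕP.n≤0⇒n≡0 fuel)) 1+p≰a
    primitive-from (suc n) {α} {a} unit-α order-α fuel | no 1+p≰a =
      step (∃nonScalarPower (proj₁ order-α) (ℕP.≤-pred (ℕP.≰⇒> 1+p≰a)))
      where
      continue : (∃₂ λ z a′ → Unit z × Order z a′ × a < a′) → ∃ λ γ → Unit γ × Primitive γ
      continue (z , a′ , unit-z , order-z , a<a′) = primitive-from n unit-z order-z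
        (ℕP.≤-pred (ℕP.<-≤-trans (ℕP.∸-monoʳ-< a<a′ (order≤1+p unit-z order-z)) fuel))
      step : (∃ λ x → Unit x × ¬ x ^ a ∈𝔽ₚ) → ∃ λ γ → Unit γ × Primitive γ
      step (x , unit-x , x^a∉𝔽ₚ) = continue (order-step unit-α order-α unit-x x^a∉𝔽ₚ)

  ∃primitive : ∃ λ γ → Unit γ × Primitive γ
  ∃primitive = primitive-from (suc p) Unit-1ₑ order-1ₑ (ℕP.m∸n≤m (suc p) 1)
    where
    order-1ₑ : Order 1ₑ 1
    order-1ₑ = s≤s z≤n , subst _∈𝔽ₚ (sym (·-identityʳ 1ₑ)) ∣0 , λ k _ → ℕD.1∣ k

  infix 4 _≈_

  _≈_ : Elt → Elt → Set
  u ≈ v = + p ∣ˢ re u - re v × + p ∣ˢ im u - im v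

  private
    difference-of-norms : ∀ D x y x′ y′ → (x * x + D * (y * y)) - (x′ * x′ + D * (y′ * y′))
                          ≡ (x - x′) * (x + x′) + D * ((y - y′) * (y + y′))
    difference-of-norms = solve-∀
    recover : ∀ a b → a - (a - b) ≡ b
    recover = solve-∀
    norm-scale : ∀ D c x y → (c * x) * (c * x) + D * ((c * y) * (c * y)) ≡ (c * c) * (x * x + D * (y * y))
    norm-scale = solve-∀
    re-difference : ∀ D x₁ y₁ x₂ y₂ z₁ w₁ z₂ w₂ → (x₁ * x₂ - D * (y₁ * y₂)) - (z₁ * z₂ - D * (w₁ * w₂))
                    ≡ (x₁ - z₁) * x₂ + z₁ * (x₂ - z₂) - D * ((y₁ - w₁) * y₂ + w₁ * (y₂ - w₂))
    re-difference = solve-∀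
    im-difference : ∀ (x₁ y₁ x₂ y₂ z₁ w₁ z₂ w₂ : ℤ) → (x₁ * y₂ + y₁ * x₂) - (z₁ * w₂ + w₁ * z₂)
                    ≡ (x₁ - z₁) * y₂ + z₁ * (y₂ - w₂) + ((y₁ - w₁) * x₂ + w₁ * (x₂ - z₂))
    im-difference = solve-∀

  ≈-∈𝔽ₚ : ∀ {u v} → u ≈ v → u ∈𝔽ₚ → v ∈𝔽ₚ
  ≈-∈𝔽ₚ {u} {v} (_ , p∣im) p∣u = subst (+ p ∣ˢ_) (recover (im u) (im v)) (ℤD.∣m∣n⇒∣m-n p∣u p∣im)

  ≈-Unit : ∀ {u v} → u ≈ v → Unit v → Unit u
  ≈-Unit {u} {v} (p∣re , p∣im) (mkUnit p∤Nv) = mkUnit λ p∣Nu → p∤Nv (subst (+ p ∣ˢ_) (recover (norm u) (norm v))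
    (ℤD.∣m∣n⇒∣m-n p∣Nu (subst (+ p ∣ˢ_) (sym (difference-of-norms (+ d) (re u) (im u) (re v) (im v)))
      (ℤD.∣m∣n⇒∣m+n (ℤD.∣m⇒∣m*n _ p∣re) (ℤD.∣n⇒∣m*n (+ d) (ℤD.∣m⇒∣m*n _ p∣im))))))

  ≈-· : ∀ {u u′ v v′} → u ≈ u′ → v ≈ v′ → u · v ≈ u′ · v′
  ≈-· {u} {u′} {v} {v′} (p∣re , p∣im) (p∣re′ , p∣im′) =
    subst (+ p ∣ˢ_) (sym (re-difference (+ d) (re u) (im u) (re v) (im v) (re u′) (im u′) (re v′) (im v′)))
      (ℤD.∣m∣n⇒∣m-n (ℤD.∣m∣n⇒∣m+n (ℤD.∣m⇒∣m*n (re v) p∣re) (ℤD.∣n⇒∣m*n (re u′) p∣re′))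
                    (ℤD.∣n⇒∣m*n (+ d) (ℤD.∣m∣n⇒∣m+n (ℤD.∣m⇒∣m*n (im v) p∣im) (ℤD.∣n⇒∣m*n (im u′) p∣im′)))) ,
    subst (+ p ∣ˢ_) (sym (im-difference (re u) (im u) (re v) (im v) (re u′) (im u′) (re v′) (im v′)))
      (ℤD.∣m∣n⇒∣m+n (ℤD.∣m∣n⇒∣m+n (ℤD.∣m⇒∣m*n (im v) p∣re) (ℤD.∣n⇒∣m*n (re u′) p∣im′))
                    (ℤD.∣m∣n⇒∣m+n (ℤD.∣m⇒∣m*n (re v) p∣im) (ℤD.∣n⇒∣m*n (im u′) p∣re′)))

  ≈-^ : ∀ {u v} → u ≈ v → ∀ k → u ^ k ≈ v ^ k
  ≈-^ u≈v zero = ∣0 , ∣0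
  ≈-^ {u} {v} u≈v (suc k) = ≈-· {u} {v} {u ^ k} {v ^ k} u≈v (≈-^ u≈v k)

  ≈-Primitive : ∀ {u v} → u ≈ v → Primitive v → Primitive u
  ≈-Primitive {u} {v} u≈v v-primitive m 0<m m≤p u^m∈𝔽ₚ =
    v-primitive m 0<m m≤p (≈-∈𝔽ₚ {u ^ m} {v ^ m} (≈-^ u≈v m) u^m∈𝔽ₚ)

  Unit-scale : ∀ {c u} → ¬ + p ∣ˢ c → Unit u → Unit (scale c u)
  Unit-scale {c} {u} p∤c (mkUnit p∤Nu) = mkUnit λ p∣N →
    [ [ p∤c , p∤c ]′ ∘ euclidsLemmaℤ p-prime c c , p∤Nu ]′
      (euclidsLemmaℤ p-prime (c * c) (norm u) (subst (+ p ∣ˢ_) (norm-scale (+ d) c (re u) (im u)) p∣N))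

  Primitive-scale : ∀ {c u} → ¬ + p ∣ˢ c → Primitive u → Primitive (scale c u)
  Primitive-scale {c} {u} p∤c u-primitive m 0<m m≤p p∣im =
    [ prime∤^ p-prime p∤c m , u-primitive m 0<m m≤p ]′
      (euclidsLemmaℤ p-prime (c ℤ.^ m) (im (u ^ m)) (subst _∈𝔽ₚ (scale-^ c u m) p∣im))

  private
    2*half≡p+1 : + 2 * half p ≡ + p + 1ℤ
    2*half≡p+1 with odd⇒≡suc[k*2] p-odd
    ... | k , p≡1+2k = begin
      + 2 * half p       ≡⟨ cong (λ n → + 2 * + n) [p+1]/2≡1+k ⟩
      + 2 * + suc k      ≡⟨ ℤP.pos-* 2 (suc k) ⟨
      + (2 ℕ.* suc k)    ≡⟨ cong +_ (trans (ℕP.*-comm 2 (suc k)) (sym p+1≡)) ⟩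
      + (p ℕ.+ 1)        ≡⟨ ℤP.pos-+ p 1 ⟩
      + p + 1ℤ           ∎
      where
      open ≡-Reasoning
      p+1≡ : p ℕ.+ 1 ≡ suc k ℕ.* 2
      p+1≡ = trans (ℕP.+-comm p 1) (cong suc p≡1+2k)
      [p+1]/2≡1+k : (p ℕ.+ 1) / 2 ≡ suc k
      [p+1]/2≡1+k = trans (cong (_/ 2) p+1≡) (m*n/n≡m (suc k) 2)

    p∤half : ¬ + p ∣ˢ half p
    p∤half p∣half = prime∤1 p-prime (subst (+ p ∣ˢ_) 2*half-p≡1 (ℤD.∣m∣n⇒∣m-n (ℤD.∣n⇒∣m*n (+ 2) p∣half) (ℤD.∣-refl {+ p})))
      where
      cancel : ∀ P H → + 2 * H ≡ P + 1ℤ → + 2 * H - P ≡ 1ℤ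
      cancel P H eq = trans (cong (_- P) eq) (simplify P)
        where
        simplify : ∀ P → P + 1ℤ - P ≡ 1ℤ
        simplify = solve-∀
      2*half-p≡1 = cancel (+ p) (half p) 2*half≡p+1

    alpha-re : ∀ b x y⁻¹ H → (- b) * H - (y⁻¹ * H) * x ≡ - (H * (b - - (x * y⁻¹)))
    alpha-re = solve-∀
    alpha-im : ∀ y y⁻¹ H → H - (y⁻¹ * H) * y ≡ - (H * (y * y⁻¹ - 1ℤ))
    alpha-im = solve-∀

  -- For a primitive γ = x + y√-d and b ≡ -x/y (mod p), (-b + √-d)/2 ≡ (y⁻¹/2)·γ.
  alpha-generates : ∃ λ b₀ → ∀ b → + p ∣ˢ b - b₀ → Generates d p (alpha p b)
  alpha-generates = fromPrimitive ∃primitive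
    where
    fromPrimitive : (∃ λ γ → Unit γ × Primitive γ) → ∃ λ b₀ → ∀ b → + p ∣ˢ b - b₀ → Generates d p (alpha p b)
    fromPrimitive (γ , unit-γ , γ-primitive) = b₀ , λ b p∣b-b₀ →
      primitive⇒generates (≈-Unit (α≈cγ b p∣b-b₀) (Unit-scale p∤c unit-γ))
                          (≈-Primitive (α≈cγ b p∣b-b₀) (Primitive-scale p∤c γ-primitive))
      where
      p∤im-γ : ¬ + p ∣ˢ im γ
      p∤im-γ p∣y = γ-primitive 1 (s≤s z≤n) (ℕP.<⇒≤ (prime>1 p-prime))
                     (subst _∈𝔽ₚ (sym (·-identityʳ γ)) p∣y)
      y⁻¹ = proj₁ (inverse-mod p-prime (im γ) p∤im-γ)
      p∣yy⁻¹-1 = proj₂ (inverse-mod p-prime (im γ) p∤im-γ)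
      b₀ = - (re γ * y⁻¹)
      c = y⁻¹ * half p
      p∤c : ¬ + p ∣ˢ c
      p∤c = [ p∤y⁻¹ , p∤half ]′ ∘ euclidsLemmaℤ p-prime y⁻¹ (half p)
        where
        p∤y⁻¹ : ¬ + p ∣ˢ y⁻¹
        p∤y⁻¹ p∣y⁻¹ = prime∤1 p-prime (subst (+ p ∣ˢ_) (recover (im γ * y⁻¹) 1ℤ)
                        (ℤD.∣m∣n⇒∣m-n (ℤD.∣n⇒∣m*n (im γ) p∣y⁻¹) p∣yy⁻¹-1))
      α≈cγ : ∀ b → + p ∣ˢ b - b₀ → alpha p b ≈ scale c γ
      α≈cγ b p∣b-b₀ = subst (+ p ∣ˢ_) (sym (alpha-re b (re γ) y⁻¹ (half p))) (ℤD.∣m⇒∣-m (ℤD.∣n⇒∣m*n (half p) p∣b-b₀))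
                     , subst (+ p ∣ˢ_) (sym (alpha-im (im γ) y⁻¹ (half p))) (ℤD.∣m⇒∣-m (ℤD.∣n⇒∣m*n (half p) p∣yy⁻¹-1))

-- Combining the primes dividing M

m*n∣ˢ⇒m∣ˢ : ∀ m k {z} → + (m ℕ.* k) ∣ˢ z → + m ∣ˢ z
m*n∣ˢ⇒m∣ˢ m k = ℤD.∣-trans (ℤD.divides (+ k) (trans (ℤP.pos-* m k) (ℤP.*-comm (+ m) (+ k))))

∣-difference-trans : ∀ {m} a b c → m ∣ˢ a - b → m ∣ˢ b - c → m ∣ˢ a - c
∣-difference-trans a b c m∣a-b m∣b-c = subst (_ ∣ˢ_) (telescope a b c) (ℤD.∣m∣n⇒∣m+n m∣a-b m∣b-c)
  where
  telescope : ∀ a b c → (a - b) + (b - c) ≡ a - c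
  telescope = solve-∀

mod4-root : ∀ {d} → NegFundDisc d → ∃ λ b₀ → + 4 ∣ˢ b₀ * b₀ + + d
mod4-root {d} (inj₁ (d%4≡3 , _)) = 1ℤ , ℤD.divides (+ (d / 4 ℕ.+ 1)) (begin
  1ℤ * 1ℤ + + d                        ≡⟨ cong (λ n → + (1 ℕ.+ n)) (m≡m%n+[m/n]*n d 4) ⟩
  + (1 ℕ.+ (d % 4 ℕ.+ d / 4 ℕ.* 4))    ≡⟨ cong (λ r → + (1 ℕ.+ (r ℕ.+ d / 4 ℕ.* 4))) d%4≡3 ⟩
  + (4 ℕ.+ d / 4 ℕ.* 4)                ≡⟨ cong +_ (rearrange (d / 4)) ⟩
  + ((d / 4 ℕ.+ 1) ℕ.* 4)              ≡⟨ ℤP.pos-* (d / 4 ℕ.+ 1) 4 ⟩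
  + (d / 4 ℕ.+ 1) * + 4                ∎)
  where
  open ≡-Reasoning
  rearrange : ∀ q → 4 ℕ.+ q ℕ.* 4 ≡ (q ℕ.+ 1) ℕ.* 4
  rearrange = ℕSolver.solve-∀
mod4-root {d} (inj₂ (m , d≡4m , _)) = 0ℤ , ℤD.divides (+ m) (begin
  0ℤ * 0ℤ + + d       ≡⟨ cong +_ d≡4m ⟩
  + (4 ℕ.* m)         ≡⟨ cong +_ (ℕP.*-comm 4 m) ⟩
  + (m ℕ.* 4)         ≡⟨ ℤP.pos-* m 4 ⟩
  + m * + 4           ∎)
  where open ≡-Reasoning

mod4-root-class : ∀ d b₀ b → + 4 ∣ˢ b₀ * b₀ + + d → + 4 ∣ˢ b - b₀ → + 4 ∣ˢ b * b + + d
mod4-root-class d b₀ b 4∣b₀²+d 4∣b-b₀ =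
  subst (+ 4 ∣ˢ_) (expand (+ d) b₀ b) (ℤD.∣m∣n⇒∣m+n 4∣b₀²+d (ℤD.∣m⇒∣m*n (b + b₀) 4∣b-b₀))
  where
  expand : ∀ D b₀ b → (b₀ * b₀ + D) + (b - b₀) * (b + b₀) ≡ b * b + D
  expand = solve-∀

module _ (d M : ℕ) (M-odd : ¬ 2 ∣ M) (inert : ∀ p → Prime p → p ∣ M → InertOdd d p) where

  GoodBelow : ℕ → ℤ → Set
  GoodBelow k b = + 4 ∣ˢ b * b + + d × (∀ p → Prime p → p < k → p ∣ M → Generates d p (alpha p b))

  -- Since every prime factor of the modulus is below k, the next prime is coprime to it
  -- and can be added by the Chinese remainder theorem.
  record GoodClass (k : ℕ) : Set where
    field
      modulus : ℕ
      residue : ℤ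
      factors<k : ∀ q → Prime q → q ∣ modulus → q < k
      good : ∀ b → + modulus ∣ˢ b - residue → GoodBelow k b

  goodClass₃ : NegFundDisc d → GoodClass 3
  goodClass₃ nfd = record
    { modulus = 4 ; residue = b₀ ; factors<k = factors<3
    ; good = λ b 4∣b-b₀ → mod4-root-class d b₀ b 4∣b₀²+d 4∣b-b₀
                        , λ p p-prime p<3 p∣M → contradiction (subst (_∣ M) (p≡2 p-prime p<3) p∣M) M-odd
    }
    where
    b₀ = proj₁ (mod4-root nfd)
    4∣b₀²+d = proj₂ (mod4-root nfd)
    factors<3 : ∀ q → Prime q → q ∣ 4 → q < 3
    factors<3 q q-prime q∣4 = [ s≤s ∘′ ℕD.∣⇒≤ , s≤s ∘′ ℕD.∣⇒≤ ]′ (euclidsLemma 2 2 q-prime q∣4)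
    p≡2 : ∀ {p} → Prime p → p < 3 → p ≡ 2
    p≡2 p-prime p<3 = ℕP.≤-antisym (ℕP.≤-pred p<3) (prime>1 p-prime)

  extendBelow : ∀ {k} b → GoodBelow k b → (Prime k → k ∣ M → Generates d k (alpha k b)) → GoodBelow (suc k) b
  extendBelow {k} b (4∣b²+d , generates<k) generatesₖ = 4∣b²+d , λ p p-prime p<1+k p∣M →
    [ (λ p<k → generates<k p p-prime p<k p∣M) , (λ { refl → generatesₖ p-prime p∣M }) ]′
      (ℕP.m≤n⇒m<n∨m≡n (ℕP.≤-pred p<1+k))

  goodClass-step : ∀ {k} → GoodClass k → GoodClass (suc k)
  goodClass-step {k} class with prime? k ×-dec k ∣? M
  ... | no ¬[k-prime×k∣M] = record
    { modulus = modulus ; residue = residue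
    ; factors<k = λ q q-prime q∣m → ℕP.m<n⇒m<1+n (factors<k q q-prime q∣m)
    ; good = λ b m∣b-r → extendBelow b (good b m∣b-r) (λ k-prime k∣M → contradiction (k-prime , k∣M) ¬[k-prime×k∣M])
    }
    where open GoodClass class
  ... | yes (k-prime , k∣M) = fromLocal (InertPrime.alpha-generates d k k-prime k-odd (inert k k-prime k∣M))
    where
    open GoodClass class
    instance _ = prime⇒nonZero k-prime
    k-odd : ¬ 2 ∣ k
    k-odd 2∣k = M-odd (ℕD.∣-trans 2∣k k∣M)
    m⊥k : Coprime modulus k
    m⊥k (i∣m , i∣k) with prime⇒irreducible k-prime i∣k
    ... | inj₁ i≡1 = i≡1
    ... | inj₂ refl = contradiction (factors<k _ k-prime i∣m) (ℕP.<-irrefl refl)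
    fromLocal : (∃ λ bₖ → ∀ b → + k ∣ˢ b - bₖ → Generates d k (alpha k b)) → GoodClass (suc k)
    fromLocal (bₖ , generatesₖ) = fromCRT (chineseRemainder m⊥k residue bₖ)
      where
      fromCRT : (∃ λ x → + modulus ∣ˢ x - residue × + k ∣ˢ x - bₖ) → GoodClass (suc k)
      fromCRT (x , m∣x-r , k∣x-bₖ) = record
        { modulus = modulus ℕ.* k ; residue = x
        ; factors<k = λ q q-prime q∣mk →
            [ (λ q∣m → ℕP.m<n⇒m<1+n (factors<k q q-prime q∣m)) , (λ q∣k → s≤s (ℕD.∣⇒≤ q∣k)) ]′
              (euclidsLemma modulus k q-prime q∣mk)
        ; good = λ b mk∣b-x → extendBelow b
            (good b (∣-difference-trans b x residue (m*n∣ˢ⇒m∣ˢ modulus k mk∣b-x) m∣x-r))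
            (λ _ _ → generatesₖ b (∣-difference-trans b x bₖ
                       (m*n∣ˢ⇒m∣ˢ k modulus (subst (λ n → + n ∣ˢ b - x) (ℕP.*-comm modulus k) mk∣b-x)) k∣x-bₖ))
        }

  goodClass : NegFundDisc d → ∀ n → GoodClass (3 ℕ.+ n)
  goodClass nfd zero = goodClass₃ nfd
  goodClass nfd (suc n) = goodClass-step (goodClass nfd n)

lemma8p1 : (d M : ℕ) → NegFundDisc d → 0 < M → ¬ (2 ∣ M) → SquareFree M
    → (∀ (p : ℕ) → Prime p → p ∣ M → InertOdd d p)
    → ∃[ b ] (((+ 4) ∣ℤ (b * b + + d))
      × (∀ (p : ℕ) → Prime p → p ∣ M → Generates d p (alpha p b)))
lemma8p1 d M nfd 0<M M-odd _ inert =
  residue , ∣⇒∣ᵤ (proj₁ good-residue) , λ p p-prime p∣M → proj₂ good-residue p p-prime (p<3+M p∣M) p∣M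
  where
  open GoodClass (goodClass d M M-odd inert nfd M)
  good-residue : GoodBelow d M M-odd inert (3 ℕ.+ M) residue
  good-residue = good residue (ℤD.divides 0ℤ (ℤP.+-inverseʳ residue))
  p<3+M : ∀ {p} → p ∣ M → p < 3 ℕ.+ M
  p<3+M p∣M = s≤s (ℕP.m≤n⇒m≤o+n 2 (ℕD.∣⇒≤ {{ℕ.>-nonZero 0<M}} p∣M))
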